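{- An even matroid stack set system is an even matroid stack delta-matroid if and only if it has no minor isomorphic to a set system in one of the following sets: (1) $\{S_{2k}*X: k\ge2,\ X\subseteq E(S_{2k}),\ |X|\ne k\}$; (2) $\{T_5,\ T_5*a,\ T_5*\{b,c,d\}\}$; (3) $\{T_6,\ T_6*a,\ T_6*b,\ T_6*\{b,c,d\}\}$; (4) $\{T_7,\ T_7*a,\ T_7*b,\ T_7*\{b,c,d\},\ T_7*\{a,c,d\},\ T_7^*\}$.
   Context: A set system is a pair $S=(E,\mathcal{F})$ with $E$ finite and $\mathcal{F}$ a collection of subsets of $E$; it is proper if $\mathcal{F}\neq\emptyset$, even if $|X|-|Y|$ is even for all $X,Y\in\mathcal{F}$. Isomorphism: a bijection $\phi:E\to E'$ with $A\in\mathcal{F}\iff\phi(A)\in\mathcal{F}'$. For proper $S$ and $e\in E$: $e$ is a loop if no feasible set contains $e$, a coloop if every feasible set contains $e$. If $e$ is not a loop, $S/e=(E-e,\{F-e:e\in F\in\mathcal{F}\})$; if $e$ is not a coloop, $S\backslash e=(E-e,\{F\in\mathcal{F}:e\notin F\})$; if $e$ is a loop or coloop, $S/e$ and $S\backslash e$ are both set equal to whichever was defined. A minor is any set system obtained by a (possibly empty) sequence of such operations. Twist: $S*A=(E,\{F\triangle A:F\in\mathcal{F}\})$, $S*a=S*\{a\}$, dual $S^*=S*E$. A delta-matroid is a proper set system such that for all $X,Y\in\mathcal{F}$ and $u\in X\triangle Y$ there is $v\in X\triangle Y$ (possibly $v=u$) with $X\triangle\{u,v\}\in\mathcal{F}$.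 The stack of a proper $S$ with smallest feasible sets of size $k$ and largest of size $\ell$ is $N_k,\ldots,N_\ell$, $N_i=(E,\{F\in\mathcal{F}:|F|=i\})$. $S$ is a matroid stack set system if every proper $N_i$ is a matroid (its feasible sets are the bases of a matroid on $E$). An even matroid stack delta-matroid is an even matroid stack set system that is a delta-matroid. $S_m=(\{e_1,\ldots,e_m\},\{\emptyset,\{e_1,\ldots,e_m\}\})$. $T_5=(\{a,b,c,d\},\{\emptyset,\{a,b\},\{a,b,c,d\}\})$; $T_6=(\{a,b,c,d\},\{\emptyset,\{a,b\},\{a,c\},\{a,b,c,d\}\})$; $T_7=(\{a,b,c,d\},\{\emptyset,\{a,b\},\{a,c\},\{a,d\},\{a,b,c,d\}\})$. -}

module Defs where

open import Data.Nat using (ℕ; suc; _+_; _*_; _≤_; _%_)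
open import Data.Bool using (Bool; true; false; _xor_; _∧_)
open import Data.Bool.Properties using () renaming (_≟_ to _≟𝔹_)
open import Data.Fin using (Fin; #_)
open import Data.Fin.Subset using (Subset; _∈_; _∉_; _∪_; _─_; ⁅_⁆; ∣_∣)
  renaming (⊤ to fullSet; ⊥ to emptySet)
open import Data.Vec using (Vec; zipWith; insertAt; tabulate; lookup)
open import Data.Vec.Properties using (≡-dec)
open import Data.List using (List; []; _∷_)
open import Data.Bool.ListAction using (any)
open import Data.Product using (Σ; _×_; ∃; ∃-syntax; _,_)
open import Data.Sum using (_⊎_)
open import Data.Empty using (⊥)
open import Relation.Nullary using (¬_; does)
open import Relation.Binary.PropositionalEquality using (_≡_; _≢_)
open import Function.Bundles using (_↔_; Inverse)

SetSystem : ℕ → Set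
SetSystem n = Subset n → Bool

Feasible : ∀ {n} → SetSystem n → Subset n → Set
Feasible S A = S A ≡ true

_△_ : ∀ {n} → Subset n → Subset n → Subset n
A △ B = zipWith _xor_ A B

Proper : ∀ {n} → SetSystem n → Set
Proper S = ∃[ A ] Feasible S A

Even : ∀ {n} → SetSystem n → Set
Even S = ∀ X Y → Feasible S X → Feasible S Y → ∣ X ∣ % 2 ≡ ∣ Y ∣ % 2

image : ∀ {n m} → Fin n ↔ Fin m → Subset n → Subset m
image φ A = tabulate (λ j → lookup A (Inverse.from φ j))

Isomorphic : ∀ {n m} → SetSystem n → SetSystem m → Set
Isomorphic {n} {m} S T = Σ (Fin n ↔ Fin m) λ φ → ∀ A → S A ≡ T (image φ A)

IsLoop : ∀ {n} → SetSystem n → Fin n → Set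
IsLoop S e = ∀ F → Feasible S F → e ∉ F

IsColoop : ∀ {n} → SetSystem n → Fin n → Set
IsColoop S e = ∀ F → Feasible S F → e ∈ F

-- The ground set E - e is identified with Fin n via insertAt/removal of
-- position e in Fin (suc n).
-- Raw contraction  { F - e : e ∈ F ∈ 𝓕 }
contractRaw : ∀ {n} → SetSystem (suc n) → Fin (suc n) → SetSystem n
contractRaw S e A = S (insertAt A e true)

deleteRaw : ∀ {n} → SetSystem (suc n) → Fin (suc n) → SetSystem n
deleteRaw S e A = S (insertAt A e false)

-- Minor relation: Minor S N means N is obtained from S by a (possibly
-- empty) sequence of contractions/deletions, with the loop/coloop
-- conventions: if e is a loop, S/e = S\e (= raw deletion); if e is a
-- coloop, S\e = S/e (= raw contraction).
data Minor : ∀ {n m} → SetSystem n → SetSystem m → Set where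
  minor-refl : ∀ {n} {S : SetSystem n} → Minor S S
  contract-nonloop : ∀ {n m} {S : SetSystem (suc n)} {N : SetSystem m} (e : Fin (suc n)) →
    ¬ IsLoop S e → Minor (contractRaw S e) N → Minor S N
  contract-loop : ∀ {n m} {S : SetSystem (suc n)} {N : SetSystem m} (e : Fin (suc n)) →
    IsLoop S e → Minor (deleteRaw S e) N → Minor S N
  delete-noncoloop : ∀ {n m} {S : SetSystem (suc n)} {N : SetSystem m} (e : Fin (suc n)) →
    ¬ IsColoop S e → Minor (deleteRaw S e) N → Minor S N
  delete-coloop : ∀ {n m} {S : SetSystem (suc n)} {N : SetSystem m} (e : Fin (suc n)) →
    IsColoop S e → Minor (contractRaw S e) N → Minor S N

twist : ∀ {n} → SetSystem n → Subset n → SetSystem n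
twist S A B = S (B △ A)

dual : ∀ {n} → SetSystem n → SetSystem n
dual S = twist S fullSet

IsDeltaMatroid : ∀ {n} → SetSystem n → Set
IsDeltaMatroid S = Proper S ×
  (∀ X Y → Feasible S X → Feasible S Y → ∀ u → u ∈ (X △ Y) →
     ∃[ v ] (v ∈ (X △ Y) × Feasible S (X △ (⁅ u ⁆ ∪ ⁅ v ⁆))))

IsMatroidBases : ∀ {n} → SetSystem n → Set
IsMatroidBases S = Proper S ×
  (∀ B₁ B₂ → Feasible S B₁ → Feasible S B₂ → ∀ x → x ∈ (B₁ ─ B₂) →
     ∃[ y ] (y ∈ (B₂ ─ B₁) × Feasible S ((B₁ ─ ⁅ x ⁆) ∪ ⁅ y ⁆)))

layer : ∀ {n} → SetSystem n → ℕ → SetSystem n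
layer S i A = S A ∧ does (∣ A ∣ Data.Nat.≟ i)

-- matroid stack: every proper N_i is a matroid.  (For i outside [k, ℓ]
-- the layer N_i is empty, hence not proper, so quantifying over all i
-- is the same as quantifying over the stack N_k, …, N_ℓ.)
IsMatroidStack : ∀ {n} → SetSystem n → Set
IsMatroidStack S = ∀ i → Proper (layer S i) → IsMatroidBases (layer S i)

IsEvenMatroidStackSetSystem : ∀ {n} → SetSystem n → Set
IsEvenMatroidStackSetSystem S = Proper S × Even S × IsMatroidStack S

IsEvenMatroidStackDeltaMatroid : ∀ {n} → SetSystem n → Set
IsEvenMatroidStackDeltaMatroid S = IsEvenMatroidStackSetSystem S × IsDeltaMatroid S

fromList : ∀ {n} → List (Subset n) → SetSystem n
fromList xs A = any (λ B → does (≡-dec _≟𝔹_ A B)) xs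

Sₘ : (m : ℕ) → SetSystem m
Sₘ m = fromList (emptySet ∷ fullSet ∷ [])

a b c d : Fin 4
a = # 0
b = # 1
c = # 2
d = # 3

pair : Fin 4 → Fin 4 → Subset 4
pair x y = ⁅ x ⁆ ∪ ⁅ y ⁆

T₅ : SetSystem 4
T₅ = fromList (emptySet ∷ pair a b ∷ fullSet ∷ [])

T₆ : SetSystem 4
T₆ = fromList (emptySet ∷ pair a b ∷ pair a c ∷ fullSet ∷ [])

T₇ : SetSystem 4
T₇ = fromList (emptySet ∷ pair a b ∷ pair a c ∷ pair a d ∷ fullSet ∷ [])

bcd acd : Subset 4
bcd = ⁅ b ⁆ ∪ (⁅ c ⁆ ∪ ⁅ d ⁆)
acd = ⁅ a ⁆ ∪ (⁅ c ⁆ ∪ ⁅ d ⁆)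

data Excluded : (m : ℕ) → SetSystem m → Set where
  ex-S : (k : ℕ) → 2 ≤ k → (X : Subset (2 * k)) → ∣ X ∣ ≢ k →
         Excluded (2 * k) (twist (Sₘ (2 * k)) X)
  ex-T5   : Excluded 4 T₅
  ex-T5a  : Excluded 4 (twist T₅ ⁅ a ⁆)
  ex-T5bcd : Excluded 4 (twist T₅ bcd)
  ex-T6   : Excluded 4 T₆
  ex-T6a  : Excluded 4 (twist T₆ ⁅ a ⁆)
  ex-T6b  : Excluded 4 (twist T₆ ⁅ b ⁆)
  ex-T6bcd : Excluded 4 (twist T₆ bcd)
  ex-T7   : Excluded 4 T₇
  ex-T7a  : Excluded 4 (twist T₇ ⁅ a ⁆)
  ex-T7b  : Excluded 4 (twist T₇ ⁅ b ⁆)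
  ex-T7bcd : Excluded 4 (twist T₇ bcd)
  ex-T7acd : Excluded 4 (twist T₇ acd)
  ex-T7dual : Excluded 4 (dual T₇)

HasExcludedMinor : ∀ {n} → SetSystem n → Set
HasExcludedMinor {n} S =
  Σ ℕ λ m → Σ (SetSystem m) λ N → Minor S N ×
  Σ ℕ λ m' → Σ (SetSystem m') λ T → Excluded m' T × Isomorphic N T

-- A delta-matroid has no violation (X, Y, u) of the exchange axiom; violations lift from a minor
-- and along isomorphisms, and every excluded system has one.  Conversely, take a violation in an even
-- matroid stack with ∣X △ Y∣ minimal.  Minimality forces every feasible set between X and Y to be X,
-- Y or Y △ {u, v}, with v ≠ u by evenness, and when ∣X △ Y∣ ≥ 5 a further exchange from X rules the
-- sets Y △ {u, v} out as well.  Moreover ∣X∣ ≠ ∣Y∣: otherwise basis exchange in their common layer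
-- would leave ∣X △ Y∣ ≤ 2, and then Y itself is some X △ {u, v}.  Fixing every element outside
-- D = X △ Y to its value in X is a sequence of contractions and deletions, since X is feasible.  The
-- resulting minor on D, of even size, is a twist of S_∣D∣ by X when ∣D∣ ≥ 6, and for ∣D∣ = 4 it is
-- one of finitely many systems, each matched with an excluded one by an exhaustive search.

module Submission where

open import Defs
open import Data.Nat using (ℕ; zero; suc; _+_; _*_; _∸_; _≤_; _<_; z≤n; s≤s; _%_; parity) renaming (_≟_ to _≟ℕ_)
open import Data.Nat.Properties using (module ≤-Reasoning; ≤-refl; ≤-trans; ≤-reflexive; ≤-pred; n≤1+n; <⇒≱;
  +-comm; +-suc; +-identityʳ; +-mono-≤; +-monoʳ-≤; *-monoʳ-≤; +-cancelʳ-≡; m+n∸m≡n)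
open import Data.Parity.Base using (0ℙ; _⁻¹) renaming (_+_ to _+ℙ_)
open import Data.Parity.Properties using (+-homo-+; suc-homo-⁻¹; ⁻¹-involutive; p+p≡0ℙ; p≢p⁻¹)
  renaming (+-cancelʳ-≡ to +ℙ-cancelʳ-≡)
open import Data.Bool using (Bool; true; false; _∧_; _∨_; not; _xor_; if_then_else_)
open import Data.Bool.Properties using (xor-same; xor-identityʳ; xor-inverseˡ; xor-inverseʳ; not-involutive;
  ∨-identityʳ; ∨-zeroʳ; ∧-identityʳ; ∧-zeroʳ; ∧-conicalˡ; ∧-conicalʳ; ¬-not; not-¬; ⇔→≡)
  renaming (_≟_ to _≟𝔹_)
open import Data.Fin using (Fin; zero; suc; #_; punchIn; punchOut) renaming (_≟_ to _≟ᶠ_)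
open import Data.Fin.Properties using (punchIn-injective; punchInᵢ≢i; punchIn-punchOut; any?)
open import Data.Fin.Subset using (Subset; ∁; ⁅_⁆; _∪_; _∩_; _─_; ∣_∣; _∈_; _⊆_) renaming (⊤ to fullSet; ⊥ to emptySet)
open import Data.Fin.Subset.Properties using (∣⊤∣≡n; ∣⁅x⁆∣≡1; ∣∁p∣≡n∸∣p∣; p⊆q⇒∣p∣≤∣q∣; p⊂q⇒∣p∣<∣q∣; ∩-comm; ∪-idem; p─⊥≡p)
open import Data.Fin.Permutation using (insert) renaming (id to idₚ)
open import Data.Vec using ([]; _∷_; lookup; tabulate; insertAt; removeAt)
open import Data.Vec.Properties using (≡-dec; lookup-zipWith; lookup-map; lookup-replicate; lookup∘tabulate;
  tabulate∘lookup; tabulate-cong; insertAt-lookup; insertAt-punchIn; insertAt-removeAt; []=⇒lookup; lookup⇒[]=)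
open import Data.List using (List; []; _∷_; [_]; map; concatMap; allFin)
open import Data.Maybe using (Maybe; just; nothing; is-just; _<∣>_)
open import Data.Product using (Σ; _×_; _,_; proj₁; proj₂; ∃)
open import Data.Sum using (_⊎_; inj₁; inj₂)
open import Data.Empty using (⊥; ⊥-elim)
open import Relation.Nullary using (Dec; yes; no; does; ¬_)
open import Relation.Nullary.Decidable using (dec-true; dec-false; decidable-stable; _×-dec_; ¬?)
open import Relation.Binary.PropositionalEquality using (_≡_; refl; sym; trans; cong; cong₂; _≢_; subst; module ≡-Reasoning)
open import Function.Base using (_∘_)
open import Function.Bundles using (_↔_; _⇔_; Inverse; mk⇔)
open import Function.Construct.Identity using (↔-id)

true≢false : true ≢ false
true≢false ()

does⇒ : ∀ {P : Set} (d : Dec P) → does d ≡ true → P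
does⇒ (yes p) _ = p

∨≡true⇒ : ∀ a {b} → a ∨ b ≡ true → a ≡ true ⊎ b ≡ true
∨≡true⇒ true _ = inj₁ refl
∨≡true⇒ false h = inj₂ h

≢not⇒≡ : ∀ {a b} → a ≢ not b → a ≡ b
≢not⇒≡ {true} {true} _ = refl
≢not⇒≡ {false} {false} _ = refl
≢not⇒≡ {true} {false} a≢nb = ⊥-elim (a≢nb refl)
≢not⇒≡ {false} {true} a≢nb = ⊥-elim (a≢nb refl)

xor-true : ∀ a → a xor true ≡ not a
xor-true true = refl
xor-true false = refl

xor≡false⇒≡ : ∀ a b → a xor b ≡ false → a ≡ b
xor≡false⇒≡ true true _ = refl
xor≡false⇒≡ false false _ = refl

xor≡true⇒≡not : ∀ a b → a xor b ≡ true → a ≡ not b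
xor≡true⇒≡not true false _ = refl
xor≡true⇒≡not false true _ = refl

infixl 9 _‼_
_‼_ : ∀ {n} → Subset n → Fin n → Bool
A ‼ i = lookup A i

doubleton : ∀ {n} → Fin n → Fin n → Subset n
doubleton x y = ⁅ x ⁆ ∪ ⁅ y ⁆

‼-ext : ∀ {n} {A B : Subset n} → (∀ i → A ‼ i ≡ B ‼ i) → A ≡ B
‼-ext {A = A} {B} h = trans (sym (tabulate∘lookup A)) (trans (tabulate-cong h) (tabulate∘lookup B))

‼-≢ : ∀ {n} {A B : Subset n} → A ≢ B → ∃ λ j → A ‼ j ≢ B ‼ j
‼-≢ {A = []} {[]} A≢B = ⊥-elim (A≢B refl)
‼-≢ {A = x ∷ A} {y ∷ B} A≢B with x ≟𝔹 y
... | no x≢y = zero , x≢y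
... | yes refl with ‼-≢ {A = A} {B} (λ A≡B → A≢B (cong (x ∷_) A≡B))
...   | j , h = suc j , h

‼-△ : ∀ {n} (A B : Subset n) i → (A △ B) ‼ i ≡ (A ‼ i xor B ‼ i)
‼-△ A B i = lookup-zipWith _xor_ i A B

‼-∪ : ∀ {n} (A B : Subset n) i → (A ∪ B) ‼ i ≡ (A ‼ i ∨ B ‼ i)
‼-∪ A B i = lookup-zipWith _∨_ i A B

‼-─ : ∀ {n} (A B : Subset n) i → (A ─ B) ‼ i ≡ (A ‼ i ∧ not (B ‼ i))
‼-─ (true ∷ A) (true ∷ B) zero = refl
‼-─ (true ∷ A) (false ∷ B) zero = refl
‼-─ (false ∷ A) (true ∷ B) zero = refl
‼-─ (false ∷ A) (false ∷ B) zero = refl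
‼-─ (_ ∷ A) (_ ∷ B) (suc i) = ‼-─ A B i

‼-∁ : ∀ {n} (A : Subset n) i → ∁ A ‼ i ≡ not (A ‼ i)
‼-∁ A i = lookup-map i not A

‼-⊥ : ∀ {n} (i : Fin n) → emptySet ‼ i ≡ false
‼-⊥ i = lookup-replicate i false

‼-⊤ : ∀ {n} (i : Fin n) → fullSet ‼ i ≡ true
‼-⊤ i = lookup-replicate i true

‼-⁅x⁆-self : ∀ {n} (x : Fin n) → ⁅ x ⁆ ‼ x ≡ true
‼-⁅x⁆-self zero = refl
‼-⁅x⁆-self (suc x) = ‼-⁅x⁆-self x

‼-⁅x⁆-other : ∀ {n} (x i : Fin n) → x ≢ i → ⁅ x ⁆ ‼ i ≡ false
‼-⁅x⁆-other zero zero x≢i = ⊥-elim (x≢i refl)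
‼-⁅x⁆-other zero (suc i) _ = ‼-⊥ i
‼-⁅x⁆-other (suc x) zero _ = refl
‼-⁅x⁆-other (suc x) (suc i) x≢i = ‼-⁅x⁆-other x i (λ x≡i → x≢i (cong suc x≡i))

‼-⁅⁆-injective : ∀ {n m} (f : Fin n → Fin m) → (∀ x y → f x ≡ f y → x ≡ y) →
  ∀ x i → ⁅ f x ⁆ ‼ f i ≡ ⁅ x ⁆ ‼ i
‼-⁅⁆-injective f f-inj x i with x ≟ᶠ i
... | yes refl = trans (‼-⁅x⁆-self (f x)) (sym (‼-⁅x⁆-self x))
... | no x≢i = trans (‼-⁅x⁆-other (f x) (f i) (λ e → x≢i (f-inj x i e))) (sym (‼-⁅x⁆-other x i x≢i))

‼-doubleton : ∀ {n} (x y i : Fin n) → doubleton x y ‼ i ≡ (⁅ x ⁆ ‼ i ∨ ⁅ y ⁆ ‼ i)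
‼-doubleton x y i = ‼-∪ ⁅ x ⁆ ⁅ y ⁆ i

‼-doubletonˡ : ∀ {n} (x y : Fin n) → doubleton x y ‼ x ≡ true
‼-doubletonˡ x y = trans (‼-doubleton x y x) (cong (_∨ ⁅ y ⁆ ‼ x) (‼-⁅x⁆-self x))

‼-doubletonʳ : ∀ {n} (x y : Fin n) → doubleton x y ‼ y ≡ true
‼-doubletonʳ x y = trans (‼-doubleton x y y) (trans (cong (⁅ x ⁆ ‼ y ∨_) (‼-⁅x⁆-self y)) (∨-zeroʳ _))

‼-doubleton-∈ : ∀ {n} (x y i : Fin n) → i ≡ x ⊎ i ≡ y → doubleton x y ‼ i ≡ true
‼-doubleton-∈ x y .x (inj₁ refl) = ‼-doubletonˡ x y
‼-doubleton-∈ x y .y (inj₂ refl) = ‼-doubletonʳ x y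

‼-doubleton-∉ : ∀ {n} (x y i : Fin n) → i ≢ x → i ≢ y → doubleton x y ‼ i ≡ false
‼-doubleton-∉ x y i i≢x i≢y =
  trans (‼-doubleton x y i) (cong₂ _∨_ (‼-⁅x⁆-other x i (λ e → i≢x (sym e))) (‼-⁅x⁆-other y i (λ e → i≢y (sym e))))

‼-doubleton-¬∉ : ∀ {n} (x y i : Fin n) → (i ≢ x → i ≢ y → ⊥) → doubleton x y ‼ i ≡ true
‼-doubleton-¬∉ x y i only with i ≟ᶠ x | i ≟ᶠ y
... | yes i≡x | _ = ‼-doubleton-∈ x y i (inj₁ i≡x)
... | no _ | yes i≡y = ‼-doubleton-∈ x y i (inj₂ i≡y)
... | no i≢x | no i≢y = ⊥-elim (only i≢x i≢y)

‼-─⁅x⁆ : ∀ {n} (p : Subset n) x i → x ≢ i → (p ─ ⁅ x ⁆) ‼ i ≡ p ‼ i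
‼-─⁅x⁆ p x i x≢i = trans (‼-─ p ⁅ x ⁆ i)
  (trans (cong (λ b → p ‼ i ∧ not b) (‼-⁅x⁆-other x i x≢i)) (∧-identityʳ (p ‼ i)))

‼-─⇒ : ∀ {n} (P Q : Subset n) i → (P ─ Q) ‼ i ≡ true → P ‼ i ≡ true × Q ‼ i ≡ false
‼-─⇒ P Q i i∈P─Q with P ‼ i | Q ‼ i | trans (sym (‼-─ P Q i)) i∈P─Q
... | true | false | _ = refl , refl

‼-─⇐ : ∀ {n} (P Q : Subset n) i → P ‼ i ≡ true → Q ‼ i ≡ false → (P ─ Q) ‼ i ≡ true
‼-─⇐ P Q i Pi Qi = trans (‼-─ P Q i) (cong₂ (λ a b → a ∧ not b) Pi Qi)

‼-swap-other : ∀ {n} (P : Subset n) x y i → i ≢ x → i ≢ y → ((P ─ ⁅ x ⁆) ∪ ⁅ y ⁆) ‼ i ≡ P ‼ i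
‼-swap-other P x y i i≢x i≢y = trans (‼-∪ (P ─ ⁅ x ⁆) ⁅ y ⁆ i)
  (trans (cong₂ _∨_ (‼-─⁅x⁆ P x i (λ e → i≢x (sym e))) (‼-⁅x⁆-other y i (λ e → i≢y (sym e)))) (∨-identityʳ (P ‼ i)))

‼-swap-removed : ∀ {n} (P : Subset n) x y → y ≢ x → ((P ─ ⁅ x ⁆) ∪ ⁅ y ⁆) ‼ x ≡ false
‼-swap-removed P x y y≢x = trans (‼-∪ (P ─ ⁅ x ⁆) ⁅ y ⁆ x) (cong₂ _∨_
  (trans (‼-─ P ⁅ x ⁆ x) (trans (cong (λ b → P ‼ x ∧ not b) (‼-⁅x⁆-self x)) (∧-zeroʳ (P ‼ x))))
  (‼-⁅x⁆-other y x y≢x))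

‼-△-≢ : ∀ {n} (Z W : Subset n) i → Z ‼ i ≢ W ‼ i → (Z △ W) ‼ i ≡ true
‼-△-≢ Z W i Zi≢Wi = trans (‼-△ Z W i) (trans (cong (Z ‼ i xor_) (¬-not (λ e → Zi≢Wi (sym e)))) (xor-inverseʳ (Z ‼ i)))

‼-△-≡ : ∀ {n} (Z W : Subset n) i → Z ‼ i ≡ W ‼ i → (Z △ W) ‼ i ≡ false
‼-△-≡ Z W i Zi≡Wi = trans (‼-△ Z W i) (trans (cong (_xor W ‼ i) Zi≡Wi) (xor-same (W ‼ i)))

‼-△-doubleton-other : ∀ {n} (Z : Subset n) a b i → i ≢ a → i ≢ b → (Z △ doubleton a b) ‼ i ≡ Z ‼ i
‼-△-doubleton-other Z a b i i≢a i≢b =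
  trans (‼-△ Z (doubleton a b) i) (trans (cong (Z ‼ i xor_) (‼-doubleton-∉ a b i i≢a i≢b)) (xor-identityʳ (Z ‼ i)))

‼-△-doubleton-∈ : ∀ {n} (Z : Subset n) a b i → doubleton a b ‼ i ≡ true → (Z △ doubleton a b) ‼ i ≡ not (Z ‼ i)
‼-△-doubleton-∈ Z a b i i∈ab = trans (‼-△ Z (doubleton a b) i) (trans (cong (Z ‼ i xor_) i∈ab) (xor-true (Z ‼ i)))

p△⊥≡p : ∀ {n} (p : Subset n) → p △ emptySet ≡ p
p△⊥≡p p = ‼-ext λ i → trans (‼-△ p emptySet i) (trans (cong (p ‼ i xor_) (‼-⊥ i)) (xor-identityʳ (p ‼ i)))

p△p≡⊥ : ∀ {n} (p : Subset n) → p △ p ≡ emptySet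
p△p≡⊥ p = ‼-ext λ i → trans (‼-△ p p i) (trans (xor-same (p ‼ i)) (sym (‼-⊥ i)))

∁p△p≡⊤ : ∀ {n} (p : Subset n) → ∁ p △ p ≡ fullSet
∁p△p≡⊤ p = ‼-ext λ i → trans (‼-△ (∁ p) p i)
  (trans (cong (_xor p ‼ i) (‼-∁ p i)) (trans (xor-inverseˡ (p ‼ i)) (sym (‼-⊤ i))))

p△q△p≡q : ∀ {n} (p q : Subset n) → (p △ q) △ p ≡ q
p△q△p≡q p q = ‼-ext λ i → trans (‼-△ (p △ q) p i) (trans (cong (_xor p ‼ i) (‼-△ p q i)) (cancel (p ‼ i) (q ‼ i)))
  where
  cancel : ∀ a b → (a xor b) xor a ≡ b
  cancel true true = refl
  cancel true false = refl
  cancel false b = xor-identityʳ b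

p△q△q≡p : ∀ {n} (p q : Subset n) → (p △ q) △ q ≡ p
p△q△q≡p p q = ‼-ext λ i → trans (‼-△ (p △ q) q i) (trans (cong (_xor q ‼ i) (‼-△ p q i)) (cancel (p ‼ i) (q ‼ i)))
  where
  cancel : ∀ a b → (a xor b) xor b ≡ a
  cancel a true = trans (xor-true (a xor true)) (trans (cong not (xor-true a)) (not-involutive a))
  cancel a false = trans (xor-identityʳ (a xor false)) (xor-identityʳ a)

p△q≡⊥⇒p≡q : ∀ {n} (p q : Subset n) → p △ q ≡ emptySet → p ≡ q
p△q≡⊥⇒p≡q p q p△q≡⊥ = ‼-ext λ i → xor≡false⇒≡ (p ‼ i) (q ‼ i)
  (trans (sym (‼-△ p q i)) (trans (cong (_‼ i) p△q≡⊥) (‼-⊥ i)))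

p△q≡⊤⇒p≡∁q : ∀ {n} (p q : Subset n) → p △ q ≡ fullSet → p ≡ ∁ q
p△q≡⊤⇒p≡∁q p q p△q≡⊤ = ‼-ext λ i → trans (xor≡true⇒≡not (p ‼ i) (q ‼ i)
  (trans (sym (‼-△ p q i)) (trans (cong (_‼ i) p△q≡⊤) (‼-⊤ i)))) (sym (‼-∁ q i))

‼⇒⊆ : ∀ {n} (P Q : Subset n) → (∀ i → P ‼ i ≡ true → Q ‼ i ≡ true) → P ⊆ Q
‼⇒⊆ P Q h {i} i∈P = lookup⇒[]= i Q (h i ([]=⇒lookup i∈P))

∣p∪q∣≤∣p∣+∣q∣ : ∀ {n} (p q : Subset n) → ∣ p ∪ q ∣ ≤ ∣ p ∣ + ∣ q ∣
∣p∪q∣≤∣p∣+∣q∣ [] [] = z≤n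
∣p∪q∣≤∣p∣+∣q∣ (true ∷ p) (true ∷ q) = s≤s (≤-trans (∣p∪q∣≤∣p∣+∣q∣ p q) (+-monoʳ-≤ ∣ p ∣ (n≤1+n _)))
∣p∪q∣≤∣p∣+∣q∣ (true ∷ p) (false ∷ q) = s≤s (∣p∪q∣≤∣p∣+∣q∣ p q)
∣p∪q∣≤∣p∣+∣q∣ (false ∷ p) (true ∷ q) = ≤-trans (s≤s (∣p∪q∣≤∣p∣+∣q∣ p q)) (≤-reflexive (sym (+-suc _ _)))
∣p∪q∣≤∣p∣+∣q∣ (false ∷ p) (false ∷ q) = ∣p∪q∣≤∣p∣+∣q∣ p q

∣doubleton∣≤2 : ∀ {n} (x y : Fin n) → ∣ doubleton x y ∣ ≤ 2
∣doubleton∣≤2 x y = ≤-trans (∣p∪q∣≤∣p∣+∣q∣ ⁅ x ⁆ ⁅ y ⁆) (≤-reflexive (cong₂ _+_ (∣⁅x⁆∣≡1 x) (∣⁅x⁆∣≡1 y)))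

∣p∣≡1+∣p─⁅x⁆∣ : ∀ {n} (p : Subset n) x → p ‼ x ≡ true → ∣ p ∣ ≡ suc ∣ p ─ ⁅ x ⁆ ∣
∣p∣≡1+∣p─⁅x⁆∣ (true ∷ p) zero refl = cong (suc ∘ ∣_∣) (sym (p─⊥≡p p))
∣p∣≡1+∣p─⁅x⁆∣ (true ∷ p) (suc x) h = cong suc (∣p∣≡1+∣p─⁅x⁆∣ p x h)
∣p∣≡1+∣p─⁅x⁆∣ (false ∷ p) (suc x) h = ∣p∣≡1+∣p─⁅x⁆∣ p x h

‼⊂⇒∣∣< : ∀ {n} (P Q : Subset n) j → (∀ i → P ‼ i ≡ true → Q ‼ i ≡ true) →
  Q ‼ j ≡ true → P ‼ j ≡ false → ∣ P ∣ < ∣ Q ∣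
‼⊂⇒∣∣< P Q j P⊆Q Qj Pj =
  p⊂q⇒∣p∣<∣q∣ (‼⇒⊆ P Q P⊆Q , j , lookup⇒[]= j Q Qj , λ j∈P → true≢false (trans (sym ([]=⇒lookup j∈P)) Pj))

only-two-members⇒∣∣≤2 : ∀ {n} (P : Subset n) x y → (∀ i → P ‼ i ≡ true → i ≢ x → i ≢ y → ⊥) → ∣ P ∣ ≤ 2
only-two-members⇒∣∣≤2 P x y only =
  ≤-trans (p⊆q⇒∣p∣≤∣q∣ (‼⇒⊆ P (doubleton x y) λ i Pi → ‼-doubleton-¬∉ x y i (only i Pi))) (∣doubleton∣≤2 x y)

only-four-members⇒∣∣≤4 : ∀ {n} (P : Subset n) x y z w →
  (∀ i → P ‼ i ≡ true → i ≢ x → i ≢ y → i ≢ z → i ≢ w → ⊥) → ∣ P ∣ ≤ 4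
only-four-members⇒∣∣≤4 P x y z w only =
  ≤-trans (p⊆q⇒∣p∣≤∣q∣ (‼⇒⊆ P (doubleton x y ∪ doubleton z w) P⊆xyzw))
    (≤-trans (∣p∪q∣≤∣p∣+∣q∣ (doubleton x y) (doubleton z w)) (+-mono-≤ (∣doubleton∣≤2 x y) (∣doubleton∣≤2 z w)))
  where
  P⊆xyzw : ∀ i → P ‼ i ≡ true → (doubleton x y ∪ doubleton z w) ‼ i ≡ true
  P⊆xyzw i Pi with i ≟ᶠ x | i ≟ᶠ y
  ... | no i≢x | no i≢y = trans (‼-∪ (doubleton x y) _ i)
    (trans (cong (_ ∨_) (‼-doubleton-¬∉ z w i (only i Pi i≢x i≢y))) (∨-zeroʳ _))
  ... | yes i≡x | _ = trans (‼-∪ (doubleton x y) _ i) (cong (_∨ _) (‼-doubleton-∈ x y i (inj₁ i≡x)))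
  ... | no _ | yes i≡y = trans (‼-∪ (doubleton x y) _ i) (cong (_∨ _) (‼-doubleton-∈ x y i (inj₂ i≡y)))

three-members⇒3≤∣∣ : ∀ {n} (P : Subset n) x y z → P ‼ x ≡ true → P ‼ y ≡ true → P ‼ z ≡ true →
  x ≢ y → x ≢ z → y ≢ z → 3 ≤ ∣ P ∣
three-members⇒3≤∣∣ P x y z Px Py Pz x≢y x≢z y≢z =
  subst (3 ≤_) (sym ∣P∣) (s≤s (subst (2 ≤_) (sym ∣P-x∣) (s≤s (subst (1 ≤_) (sym ∣P-x-y∣) (s≤s z≤n)))))
  where
  ∣P∣ = ∣p∣≡1+∣p─⁅x⁆∣ P x Px
  ∣P-x∣ = ∣p∣≡1+∣p─⁅x⁆∣ (P ─ ⁅ x ⁆) y (trans (‼-─⁅x⁆ P x y x≢y) Py)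
  ∣P-x-y∣ = ∣p∣≡1+∣p─⁅x⁆∣ (P ─ ⁅ x ⁆ ─ ⁅ y ⁆) z (trans (‼-─⁅x⁆ (P ─ ⁅ x ⁆) y z y≢z) (trans (‼-─⁅x⁆ P x z x≢z) Pz))

∣∣≤2⇒⊆doubleton : ∀ {n} (P : Subset n) x → P ‼ x ≡ true → ∣ P ∣ ≤ 2 →
  ∃ λ y → P ‼ y ≡ true × (∀ i → P ‼ i ≡ true → i ≢ x → i ≢ y → ⊥)
∣∣≤2⇒⊆doubleton P x Px ∣P∣≤2 with any? (λ y → (P ‼ y ≟𝔹 true) ×-dec ¬? (y ≟ᶠ x))
... | yes (y , Py , y≢x) = y , Py , λ i Pi i≢x i≢y →
  <⇒≱ (s≤s (s≤s (s≤s z≤n))) (≤-trans (three-members⇒3≤∣∣ P x y i Px Py Pi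
    (λ e → y≢x (sym e)) (λ e → i≢x (sym e)) (λ e → i≢y (sym e))) ∣P∣≤2)
... | no no-other = x , Px , λ i Pi i≢x _ → no-other (i , Pi , i≢x)

∣p∣≡∣p─q∣+∣p∩q∣ : ∀ {n} (p q : Subset n) → ∣ p ∣ ≡ ∣ p ─ q ∣ + ∣ p ∩ q ∣
∣p∣≡∣p─q∣+∣p∩q∣ [] [] = refl
∣p∣≡∣p─q∣+∣p∩q∣ (true ∷ p) (true ∷ q) = trans (cong suc (∣p∣≡∣p─q∣+∣p∩q∣ p q)) (sym (+-suc _ _))
∣p∣≡∣p─q∣+∣p∩q∣ (true ∷ p) (false ∷ q) = cong suc (∣p∣≡∣p─q∣+∣p∩q∣ p q)
∣p∣≡∣p─q∣+∣p∩q∣ (false ∷ p) (true ∷ q) = ∣p∣≡∣p─q∣+∣p∩q∣ p q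
∣p∣≡∣p─q∣+∣p∩q∣ (false ∷ p) (false ∷ q) = ∣p∣≡∣p─q∣+∣p∩q∣ p q

∣p△q∣≡∣p─q∣+∣q─p∣ : ∀ {n} (p q : Subset n) → ∣ p △ q ∣ ≡ ∣ p ─ q ∣ + ∣ q ─ p ∣
∣p△q∣≡∣p─q∣+∣q─p∣ [] [] = refl
∣p△q∣≡∣p─q∣+∣q─p∣ (true ∷ p) (true ∷ q) = ∣p△q∣≡∣p─q∣+∣q─p∣ p q
∣p△q∣≡∣p─q∣+∣q─p∣ (true ∷ p) (false ∷ q) = cong suc (∣p△q∣≡∣p─q∣+∣q─p∣ p q)
∣p△q∣≡∣p─q∣+∣q─p∣ (false ∷ p) (true ∷ q) = trans (cong suc (∣p△q∣≡∣p─q∣+∣q─p∣ p q)) (sym (+-suc _ _))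
∣p△q∣≡∣p─q∣+∣q─p∣ (false ∷ p) (false ∷ q) = ∣p△q∣≡∣p─q∣+∣q─p∣ p q

∣p∣≡∣q∣⇒∣p─q∣≡∣q─p∣ : ∀ {n} (p q : Subset n) → ∣ p ∣ ≡ ∣ q ∣ → ∣ p ─ q ∣ ≡ ∣ q ─ p ∣
∣p∣≡∣q∣⇒∣p─q∣≡∣q─p∣ p q ∣p∣≡∣q∣ = +-cancelʳ-≡ ∣ p ∩ q ∣ _ _ (begin
  ∣ p ─ q ∣ + ∣ p ∩ q ∣  ≡⟨ sym (∣p∣≡∣p─q∣+∣p∩q∣ p q) ⟩
  ∣ p ∣                  ≡⟨ ∣p∣≡∣q∣ ⟩
  ∣ q ∣                  ≡⟨ ∣p∣≡∣p─q∣+∣p∩q∣ q p ⟩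
  ∣ q ─ p ∣ + ∣ q ∩ p ∣  ≡⟨ cong (λ r → ∣ q ─ p ∣ + ∣ r ∣) (∩-comm q p) ⟩
  ∣ q ─ p ∣ + ∣ p ∩ q ∣  ∎)
  where open ≡-Reasoning

parity-suc : ∀ n → parity (suc n) ≡ parity n ⁻¹
parity-suc n = trans (sym (⁻¹-involutive (parity (suc n)))) (cong _⁻¹ (suc-homo-⁻¹ n))

parity-%2 : ∀ n → parity (n % 2) ≡ parity n
parity-%2 zero = refl
parity-%2 (suc zero) = refl
parity-%2 (suc (suc n)) = parity-%2 n

%2-cong-parity : ∀ m n → m % 2 ≡ n % 2 → parity m ≡ parity n
%2-cong-parity m n m≡n = trans (sym (parity-%2 m)) (trans (cong parity m≡n) (parity-%2 n))

parity≡0ℙ⇒double : ∀ n → parity n ≡ 0ℙ → ∃ λ k → n ≡ k + k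
parity≡0ℙ⇒double zero _ = 0 , refl
parity≡0ℙ⇒double (suc zero) ()
parity≡0ℙ⇒double (suc (suc n)) even with parity≡0ℙ⇒double n even
... | k , n≡k+k = suc k , cong suc (trans (cong suc n≡k+k) (sym (+-suc k k)))

parity-△ : ∀ {n} (p q : Subset n) → parity ∣ p ∣ ≡ parity ∣ q ∣ → parity ∣ p △ q ∣ ≡ 0ℙ
parity-△ p q same = begin
  parity ∣ p △ q ∣                          ≡⟨ cong parity (∣p△q∣≡∣p─q∣+∣q─p∣ p q) ⟩
  parity (∣ p ─ q ∣ + ∣ q ─ p ∣)            ≡⟨ +-homo-+ ∣ p ─ q ∣ ∣ q ─ p ∣ ⟩
  parity ∣ p ─ q ∣ +ℙ parity ∣ q ─ p ∣      ≡⟨ cong (_+ℙ parity ∣ q ─ p ∣) same-differences ⟩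
  parity ∣ q ─ p ∣ +ℙ parity ∣ q ─ p ∣      ≡⟨ p+p≡0ℙ (parity ∣ q ─ p ∣) ⟩
  0ℙ                                        ∎
  where
  open ≡-Reasoning
  same-differences : parity ∣ p ─ q ∣ ≡ parity ∣ q ─ p ∣
  same-differences = +ℙ-cancelʳ-≡ (parity ∣ p ∩ q ∣) _ _ (begin
    parity ∣ p ─ q ∣ +ℙ parity ∣ p ∩ q ∣  ≡⟨ sym (+-homo-+ ∣ p ─ q ∣ ∣ p ∩ q ∣) ⟩
    parity (∣ p ─ q ∣ + ∣ p ∩ q ∣)        ≡⟨ cong parity (sym (∣p∣≡∣p─q∣+∣p∩q∣ p q)) ⟩
    parity ∣ p ∣                          ≡⟨ same ⟩
    parity ∣ q ∣                          ≡⟨ cong parity (∣p∣≡∣p─q∣+∣p∩q∣ q p) ⟩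
    parity (∣ q ─ p ∣ + ∣ q ∩ p ∣)        ≡⟨ +-homo-+ ∣ q ─ p ∣ ∣ q ∩ p ∣ ⟩
    parity ∣ q ─ p ∣ +ℙ parity ∣ q ∩ p ∣  ≡⟨ cong (λ r → parity ∣ q ─ p ∣ +ℙ parity ∣ r ∣) (∩-comm q p) ⟩
    parity ∣ q ─ p ∣ +ℙ parity ∣ p ∩ q ∣  ∎)

parity-△⁅x⁆ : ∀ {n} (p : Subset n) x → parity ∣ p △ ⁅ x ⁆ ∣ ≡ parity ∣ p ∣ ⁻¹
parity-△⁅x⁆ (true ∷ p) zero rewrite p△⊥≡p p = sym (suc-homo-⁻¹ ∣ p ∣)
parity-△⁅x⁆ (false ∷ p) zero rewrite p△⊥≡p p = parity-suc ∣ p ∣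
parity-△⁅x⁆ (true ∷ p) (suc x) =
  trans (parity-suc ∣ p △ ⁅ x ⁆ ∣) (trans (cong _⁻¹ (parity-△⁅x⁆ p x)) (cong _⁻¹ (sym (parity-suc ∣ p ∣))))
parity-△⁅x⁆ (false ∷ p) (suc x) = parity-△⁅x⁆ p x

even-size-cases : ∀ d → parity d ≡ 0ℙ → d ≤ 2 ⊎ d ≡ 4 ⊎ 6 ≤ d
even-size-cases 0 _ = inj₁ z≤n
even-size-cases 2 _ = inj₁ (s≤s (s≤s z≤n))
even-size-cases 4 _ = inj₂ (inj₁ refl)
even-size-cases (suc (suc (suc (suc (suc (suc d)))))) _ = inj₂ (inj₂ (s≤s (s≤s (s≤s (s≤s (s≤s (s≤s z≤n)))))))

half-of-≥6 : ∀ k → 6 ≤ k + k → 2 ≤ k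
half-of-≥6 (suc (suc k)) _ = s≤s (s≤s z≤n)
half-of-≥6 (suc zero) (s≤s (s≤s ()))

data PunchView {n} (e : Fin (suc n)) : Fin (suc n) → Set where
  at-e : PunchView e e
  punched : (k : Fin n) → PunchView e (punchIn e k)

punchView : ∀ {n} (e i : Fin (suc n)) → PunchView e i
punchView e i with e ≟ᶠ i
... | yes refl = at-e
... | no e≢i = subst (PunchView e) (punchIn-punchOut e≢i) (punched (punchOut e≢i))

‼-ext-punched : ∀ {n} {A B : Subset (suc n)} e → A ‼ e ≡ B ‼ e →
  (∀ k → A ‼ punchIn e k ≡ B ‼ punchIn e k) → A ≡ B
‼-ext-punched {A = A} {B} e at-e≡ punched≡ = ‼-ext λ i → pointwise i (punchView e i)
  where
  pointwise : ∀ i → PunchView e i → A ‼ i ≡ B ‼ i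
  pointwise .e at-e = at-e≡
  pointwise .(punchIn e k) (punched k) = punched≡ k

insertAt-△ : ∀ {n} (A B : Subset n) e a b → insertAt (A △ B) e (a xor b) ≡ insertAt A e a △ insertAt B e b
insertAt-△ A B e a b = ‼-ext-punched e
  (trans (insertAt-lookup (A △ B) e _)
    (sym (trans (‼-△ (insertAt A e a) _ e) (cong₂ _xor_ (insertAt-lookup A e a) (insertAt-lookup B e b)))))
  λ k → trans (insertAt-punchIn (A △ B) e _ k) (trans (‼-△ A B k)
    (sym (trans (‼-△ (insertAt A e a) _ (punchIn e k)) (cong₂ _xor_ (insertAt-punchIn A e a k) (insertAt-punchIn B e b k)))))

insertAt-doubleton : ∀ {n} e (x y : Fin n) → insertAt (doubleton x y) e false ≡ doubleton (punchIn e x) (punchIn e y)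
insertAt-doubleton e x y = ‼-ext-punched e
  (trans (insertAt-lookup (doubleton x y) e false)
    (sym (‼-doubleton-∉ (punchIn e x) (punchIn e y) e (λ e≡ → punchInᵢ≢i e x (sym e≡)) (λ e≡ → punchInᵢ≢i e y (sym e≡)))))
  λ k → trans (insertAt-punchIn (doubleton x y) e false k) (trans (‼-doubleton x y k)
    (sym (trans (‼-doubleton (punchIn e x) (punchIn e y) (punchIn e k))
      (cong₂ _∨_ (‼-⁅⁆-injective (punchIn e) (punchIn-injective e) x k)
                 (‼-⁅⁆-injective (punchIn e) (punchIn-injective e) y k)))))

‼-removeAt : ∀ {n} (V : Subset (suc n)) e k → removeAt V e ‼ k ≡ V ‼ punchIn e k
‼-removeAt V e k = trans (sym (insertAt-punchIn (removeAt V e) e (V ‼ e) k)) (cong (_‼ punchIn e k) (insertAt-removeAt V e))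

∣insertAt∣ : ∀ {n} (V : Subset n) e b → ∣ insertAt V e b ∣ ≡ ∣ b ∷ V ∣
∣insertAt∣ V zero b = refl
∣insertAt∣ (true ∷ V) (suc e) true = cong suc (∣insertAt∣ V e true)
∣insertAt∣ (true ∷ V) (suc e) false = cong suc (∣insertAt∣ V e false)
∣insertAt∣ (false ∷ V) (suc e) true = ∣insertAt∣ V e true
∣insertAt∣ (false ∷ V) (suc e) false = ∣insertAt∣ V e false

∣removeAt∣ : ∀ {n} (V : Subset (suc n)) e → V ‼ e ≡ false → ∣ removeAt V e ∣ ≡ ∣ V ∣
∣removeAt∣ V e Ve≡false = begin
  ∣ removeAt V e ∣                    ≡⟨ sym (∣insertAt∣ (removeAt V e) e false) ⟩
  ∣ insertAt (removeAt V e) e false ∣ ≡⟨ cong (λ b → ∣ insertAt (removeAt V e) e b ∣) (sym Ve≡false) ⟩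
  ∣ insertAt (removeAt V e) e (V ‼ e) ∣ ≡⟨ cong ∣_∣ (insertAt-removeAt V e) ⟩
  ∣ V ∣                               ∎
  where open ≡-Reasoning

module _ {n m} (φ : Fin n ↔ Fin m) where
  open Inverse φ using (to; from; strictlyInverseˡ; strictlyInverseʳ)

  preimage : Subset m → Subset n
  preimage A = tabulate (λ i → A ‼ to i)

  ‼-preimage : ∀ A i → preimage A ‼ i ≡ A ‼ to i
  ‼-preimage A = lookup∘tabulate (λ i → A ‼ to i)

  image-preimage : ∀ A → image φ (preimage A) ≡ A
  image-preimage A = ‼-ext λ j →
    trans (lookup∘tabulate _ j) (trans (‼-preimage A (from j)) (cong (A ‼_) (strictlyInverseˡ j)))

  preimage-△ : ∀ A B → preimage (A △ B) ≡ preimage A △ preimage B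
  preimage-△ A B = ‼-ext λ i → trans (‼-preimage (A △ B) i) (trans (‼-△ A B (to i))
    (sym (trans (‼-△ (preimage A) (preimage B) i) (cong₂ _xor_ (‼-preimage A i) (‼-preimage B i)))))

  preimage-doubleton : ∀ x y → preimage (doubleton x y) ≡ doubleton (from x) (from y)
  preimage-doubleton x y = ‼-ext λ i → trans (‼-preimage (doubleton x y) i) (trans (‼-doubleton x y (to i))
    (sym (trans (‼-doubleton (from x) (from y) i) (cong₂ _∨_ (‼-⁅from⁆ x i) (‼-⁅from⁆ y i)))))
    where
    from-injective : ∀ a b → from a ≡ from b → a ≡ b
    from-injective a b e = trans (sym (strictlyInverseˡ a)) (trans (cong to e) (strictlyInverseˡ b))
    ‼-⁅from⁆ : ∀ a i → ⁅ from a ⁆ ‼ i ≡ ⁅ a ⁆ ‼ to i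
    ‼-⁅from⁆ a i = trans (cong (⁅ from a ⁆ ‼_) (sym (strictlyInverseʳ i))) (‼-⁅⁆-injective from from-injective a (to i))

Sₘ-∅ : ∀ m → Sₘ m emptySet ≡ true
Sₘ-∅ m rewrite dec-true (≡-dec _≟𝔹_ (emptySet {m}) emptySet) refl = refl

Sₘ-⊤ : ∀ m → Sₘ m fullSet ≡ true
Sₘ-⊤ m rewrite dec-true (≡-dec _≟𝔹_ (fullSet {m}) fullSet) refl = ∨-zeroʳ _

Sₘ-feasible⇒ : ∀ {m} (A : Subset m) → Sₘ m A ≡ true → A ≡ emptySet ⊎ A ≡ fullSet
Sₘ-feasible⇒ A h with ∨≡true⇒ _ h
... | inj₁ A≡∅ = inj₁ (does⇒ (≡-dec _≟𝔹_ A emptySet) A≡∅)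
... | inj₂ A≡⊤ = inj₂ (does⇒ (≡-dec _≟𝔹_ A fullSet) (trans (sym (∨-identityʳ _)) A≡⊤))

twisted-Sₘ-∋ : ∀ {m} (X : Subset m) → twist (Sₘ m) X X ≡ true
twisted-Sₘ-∋ {m} X = trans (cong (Sₘ m) (p△p≡⊥ X)) (Sₘ-∅ m)

twisted-Sₘ-∋∁ : ∀ {m} (X : Subset m) → twist (Sₘ m) X (∁ X) ≡ true
twisted-Sₘ-∋∁ {m} X = trans (cong (Sₘ m) (∁p△p≡⊤ X)) (Sₘ-⊤ m)

twisted-Sₘ-feasible⇒ : ∀ {m} (X A : Subset m) → twist (Sₘ m) X A ≡ true → A ≡ X ⊎ A ≡ ∁ X
twisted-Sₘ-feasible⇒ X A A∈S with Sₘ-feasible⇒ (A △ X) A∈S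
... | inj₁ A△X≡⊥ = inj₁ (p△q≡⊥⇒p≡q A X A△X≡⊥)
... | inj₂ A△X≡⊤ = inj₂ (p△q≡⊤⇒p≡∁q A X A△X≡⊤)

-- Violations of the exchange axiom

record Violation {n} (S : SetSystem n) : Set where
  constructor violation
  field
    X Y : Subset n
    u : Fin n
    X-feasible : S X ≡ true
    Y-feasible : S Y ≡ true
    u∈X△Y : (X △ Y) ‼ u ≡ true
    no-exchange : ∀ v → (X △ Y) ‼ v ≡ true → S (X △ doubleton u v) ≡ false

delta-matroid⇒¬violation : ∀ {n} {S : SetSystem n} → IsDeltaMatroid S → ¬ Violation S
delta-matroid⇒¬violation (_ , exchange) (violation X Y u X∈S Y∈S u∈X△Y no-exchange)
  with exchange X Y X∈S Y∈S u (lookup⇒[]= u (X △ Y) u∈X△Y)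
... | v , v∈X△Y , exchanged = true≢false (trans (sym exchanged) (no-exchange v ([]=⇒lookup v∈X△Y)))

insertAt-violation : ∀ {n} (S : SetSystem (suc n)) e b → Violation (λ A → S (insertAt A e b)) → Violation S
insertAt-violation S e b (violation X Y u X∈S Y∈S u∈X△Y no-exchange) =
  violation (insertAt X e b) (insertAt Y e b) (punchIn e u) X∈S Y∈S (trans (‼-punched u) u∈X△Y) no-exchange′
  where
  X̂△Ŷ : insertAt X e b △ insertAt Y e b ≡ insertAt (X △ Y) e false
  X̂△Ŷ = trans (sym (insertAt-△ X Y e b b)) (cong (insertAt (X △ Y) e) (xor-same b))
  ‼-punched : ∀ k → (insertAt X e b △ insertAt Y e b) ‼ punchIn e k ≡ (X △ Y) ‼ k
  ‼-punched k = trans (cong (_‼ punchIn e k) X̂△Ŷ) (insertAt-punchIn (X △ Y) e false k)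
  exchanged : ∀ k → insertAt (X △ doubleton u k) e b ≡ insertAt X e b △ doubleton (punchIn e u) (punchIn e k)
  exchanged k = trans (cong (insertAt (X △ doubleton u k) e) (sym (xor-identityʳ b)))
    (trans (insertAt-△ X (doubleton u k) e b false) (cong (insertAt X e b △_) (insertAt-doubleton e u k)))
  no-exchange′ : ∀ v → (insertAt X e b △ insertAt Y e b) ‼ v ≡ true →
    S (insertAt X e b △ doubleton (punchIn e u) v) ≡ false
  no-exchange′ v v∈ with punchView e v
  ... | at-e = ⊥-elim (true≢false (trans (sym v∈) (trans (cong (_‼ e) X̂△Ŷ) (insertAt-lookup (X △ Y) e false))))
  ... | punched k = trans (cong S (sym (exchanged k))) (no-exchange k (trans (sym (‼-punched k)) v∈))

minor-violation : ∀ {n m} {S : SetSystem n} {N : SetSystem m} → Minor S N → Violation N → Violation S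
minor-violation minor-refl v = v
minor-violation {S = S} (contract-nonloop e _ S/e≼N) v = insertAt-violation S e true (minor-violation S/e≼N v)
minor-violation {S = S} (contract-loop e _ S\e≼N) v = insertAt-violation S e false (minor-violation S\e≼N v)
minor-violation {S = S} (delete-noncoloop e _ S\e≼N) v = insertAt-violation S e false (minor-violation S\e≼N v)
minor-violation {S = S} (delete-coloop e _ S/e≼N) v = insertAt-violation S e true (minor-violation S/e≼N v)

isomorphic-violation : ∀ {n m} {N : SetSystem n} {T : SetSystem m} → Isomorphic N T → Violation T → Violation N
isomorphic-violation {N = N} {T} (φ , N≅T) (violation X Y u X∈T Y∈T u∈X△Y no-exchange) =
  violation (preimage φ X) (preimage φ Y) (from u) (feasible X X∈T) (feasible Y Y∈T) u′∈ no-exchange′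
  where
  open Inverse φ using (to; from; strictlyInverseˡ; strictlyInverseʳ)
  N∘preimage : ∀ A → N (preimage φ A) ≡ T A
  N∘preimage A = trans (N≅T (preimage φ A)) (cong T (image-preimage φ A))
  feasible : ∀ A → T A ≡ true → N (preimage φ A) ≡ true
  feasible A A∈T = trans (N∘preimage A) A∈T
  ‼-preimage-△ : ∀ i → (preimage φ X △ preimage φ Y) ‼ i ≡ (X △ Y) ‼ to i
  ‼-preimage-△ i = trans (cong (_‼ i) (sym (preimage-△ φ X Y))) (‼-preimage φ (X △ Y) i)
  u′∈ : (preimage φ X △ preimage φ Y) ‼ from u ≡ true
  u′∈ = trans (‼-preimage-△ (from u)) (trans (cong ((X △ Y) ‼_) (strictlyInverseˡ u)) u∈X△Y)
  no-exchange′ : ∀ v → (preimage φ X △ preimage φ Y) ‼ v ≡ true →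
    N (preimage φ X △ doubleton (from u) v) ≡ false
  no-exchange′ v v∈ = trans (cong N exchanged) (trans (N∘preimage _) (no-exchange (to v) (trans (sym (‼-preimage-△ v)) v∈)))
    where
    exchanged : preimage φ X △ doubleton (from u) v ≡ preimage φ (X △ doubleton u (to v))
    exchanged = sym (trans (preimage-△ φ X (doubleton u (to v))) (cong (preimage φ X △_)
      (trans (preimage-doubleton φ u (to v)) (cong (doubleton (from u)) (strictlyInverseʳ v)))))

allFinᵇ : ∀ n → (Fin n → Bool) → Bool
allFinᵇ zero P = true
allFinᵇ (suc n) P = P zero ∧ allFinᵇ n (P ∘ suc)

allFinᵇ-sound : ∀ n P → allFinᵇ n P ≡ true → ∀ i → P i ≡ true
allFinᵇ-sound (suc n) P h zero = ∧-conicalˡ (P zero) _ h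
allFinᵇ-sound (suc n) P h (suc i) = allFinᵇ-sound n (P ∘ suc) (∧-conicalʳ (P zero) _ h) i

isViolationᵇ : ∀ {n} → SetSystem n → Subset n → Subset n → Fin n → Bool
isViolationᵇ {n} T X Y u =
  T X ∧ T Y ∧ (X △ Y) ‼ u ∧ allFinᵇ n (λ v → not ((X △ Y) ‼ v ∧ T (X △ doubleton u v)))

isViolationᵇ-sound : ∀ {n} (T : SetSystem n) X Y u → isViolationᵇ T X Y u ≡ true → Violation T
isViolationᵇ-sound {n} T X Y u h = violation X Y u
  (∧-conicalˡ _ _ h) (∧-conicalˡ _ _ h₁) (∧-conicalˡ _ _ h₂) no-exchange
  where
  h₁ = ∧-conicalʳ (T X) _ h
  h₂ = ∧-conicalʳ (T Y) _ h₁
  no-exchange : ∀ v → (X △ Y) ‼ v ≡ true → T (X △ doubleton u v) ≡ false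
  no-exchange v v∈ with allFinᵇ-sound n _ (∧-conicalʳ ((X △ Y) ‼ u) _ h₂) v
  ... | none rewrite v∈ = ¬-not λ exchanged → not-¬ (cong not exchanged) none

twisted-Sₘ-violation : ∀ m → 3 ≤ m → (X : Subset m) → Violation (twist (Sₘ m) X)
twisted-Sₘ-violation (suc m) 3≤m X = violation X (∁ X) zero (twisted-Sₘ-∋ X) (twisted-Sₘ-∋∁ X)
  (trans (‼-△ X (∁ X) zero) (trans (cong (X ‼ zero xor_) (‼-∁ X zero)) (xor-inverseʳ (X ‼ zero))))
  no-exchange
  where
  no-exchange : ∀ v → (X △ ∁ X) ‼ v ≡ true → Sₘ (suc m) ((X △ doubleton zero v) △ X) ≡ false
  no-exchange v _ rewrite p△q△p≡q X (doubleton zero v) = ¬-not λ feasible → neither (Sₘ-feasible⇒ _ feasible)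
    where
    neither : doubleton zero v ≡ emptySet ⊎ doubleton zero v ≡ fullSet → ⊥
    neither (inj₁ d≡∅) = true≢false (trans (sym (‼-doubletonˡ zero v))
      (trans (cong (λ (A : Subset (suc m)) → A ‼ zero) d≡∅) (‼-⊥ {suc m} zero)))
    neither (inj₂ d≡⊤) = <⇒≱ 3≤m (≤-trans (≤-reflexive (sym (trans (cong ∣_∣ d≡⊤) (∣⊤∣≡n (suc m))))) (∣doubleton∣≤2 zero v))

excluded-violation : ∀ {m} {T : SetSystem m} → Excluded m T → Violation T
excluded-violation (ex-S k 2≤k X _) = twisted-Sₘ-violation (2 * k) (≤-trans {3} {4} (s≤s (s≤s (s≤s z≤n))) (*-monoʳ-≤ 2 2≤k)) X
excluded-violation ex-T5 = isViolationᵇ-sound _ (false ∷ false ∷ false ∷ false ∷ []) (true ∷ true ∷ true ∷ true ∷ []) (# 2) refl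
excluded-violation ex-T5a = isViolationᵇ-sound _ (true ∷ false ∷ false ∷ false ∷ []) (false ∷ true ∷ true ∷ true ∷ []) (# 2) refl
excluded-violation ex-T5bcd = isViolationᵇ-sound _ (true ∷ false ∷ false ∷ false ∷ []) (false ∷ true ∷ true ∷ true ∷ []) (# 0) refl
excluded-violation ex-T6 = isViolationᵇ-sound _ (false ∷ false ∷ false ∷ false ∷ []) (true ∷ true ∷ true ∷ true ∷ []) (# 3) refl
excluded-violation ex-T6a = isViolationᵇ-sound _ (true ∷ false ∷ false ∷ false ∷ []) (false ∷ true ∷ true ∷ true ∷ []) (# 3) refl
excluded-violation ex-T6b = isViolationᵇ-sound _ (false ∷ true ∷ false ∷ false ∷ []) (true ∷ false ∷ true ∷ true ∷ []) (# 3) refl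
excluded-violation ex-T6bcd = isViolationᵇ-sound _ (true ∷ false ∷ false ∷ false ∷ []) (false ∷ true ∷ true ∷ true ∷ []) (# 0) refl
excluded-violation ex-T7 = isViolationᵇ-sound _ (true ∷ true ∷ true ∷ true ∷ []) (false ∷ false ∷ false ∷ false ∷ []) (# 0) refl
excluded-violation ex-T7a = isViolationᵇ-sound _ (false ∷ true ∷ true ∷ true ∷ []) (true ∷ false ∷ false ∷ false ∷ []) (# 0) refl
excluded-violation ex-T7b = isViolationᵇ-sound _ (true ∷ false ∷ true ∷ true ∷ []) (false ∷ true ∷ false ∷ false ∷ []) (# 0) refl
excluded-violation ex-T7bcd = isViolationᵇ-sound _ (true ∷ false ∷ false ∷ false ∷ []) (false ∷ true ∷ true ∷ true ∷ []) (# 0) refl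
excluded-violation ex-T7acd = isViolationᵇ-sound _ (false ∷ true ∷ false ∷ false ∷ []) (true ∷ false ∷ true ∷ true ∷ []) (# 0) refl
excluded-violation ex-T7dual = isViolationᵇ-sound _ (false ∷ false ∷ false ∷ false ∷ []) (true ∷ true ∷ true ∷ true ∷ []) (# 0) refl

delta-matroid⇒¬excluded-minor : ∀ {n} {S : SetSystem n} → IsDeltaMatroid S → ¬ HasExcludedMinor S
delta-matroid⇒¬excluded-minor dm (_ , _ , S≼N , _ , _ , excluded , N≅T) =
  delta-matroid⇒¬violation dm (minor-violation S≼N (isomorphic-violation N≅T (excluded-violation excluded)))

-- Restriction to a subset of the ground set

-- e is not a loop if X ∋ e and not a coloop otherwise, so fixing e to its value in the feasible X is a
-- genuine contraction or deletion.
fix-minor : ∀ {n} (S : SetSystem (suc n)) e X → S X ≡ true → ∀ {m} {N : SetSystem m} →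
  Minor (λ A → S (insertAt A e (X ‼ e))) N → Minor S N
fix-minor S e X X∈S S↾e≼N with X ‼ e in Xe
... | true = contract-nonloop e (λ loop → loop X X∈S (lookup⇒[]= e X Xe)) S↾e≼N
... | false = delete-noncoloop e (λ coloop → true≢false (trans (sym ([]=⇒lookup (coloop X X∈S))) Xe)) S↾e≼N

-- The minor of S on the ground set D obtained by fixing every element outside D to its value in X.
-- Its ground set is Fin m, placed inside Fin n by pos; extend A is A filled up with X outside D.
record Restriction {n} (S : SetSystem n) (D X : Subset n) : Set where
  field
    m : ℕ
    N : SetSystem m
    minor : Minor S N
    extend : Subset m → Subset n
    pos : Fin m → Fin n
    N≡S∘extend : ∀ A → N A ≡ S (extend A)
    ‼-extend-pos : ∀ A j → extend A ‼ pos j ≡ A ‼ j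
    ‼-extend-off-D : ∀ A i → D ‼ i ≡ false → extend A ‼ i ≡ X ‼ i
    pos∈D : ∀ j → D ‼ pos j ≡ true
    pos-onto-D : ∀ i → D ‼ i ≡ true → ∃ λ j → pos j ≡ i
    pos-injective : ∀ j j′ → pos j ≡ pos j′ → j ≡ j′
    m≡∣D∣ : m ≡ ∣ D ∣
    extend-size : ∀ A B → ∣ extend A ∣ + ∣ B ∣ ≡ ∣ extend B ∣ + ∣ A ∣

whole-restriction : ∀ {n} (S : SetSystem n) D X → (∀ e → D ‼ e ≡ true) → Restriction S D X
whole-restriction {n} S D X D≡⊤ = record
  { m = n ; N = S ; minor = minor-refl ; extend = λ A → A ; pos = λ j → j
  ; N≡S∘extend = λ A → refl ; ‼-extend-pos = λ A j → refl
  ; ‼-extend-off-D = λ A i Di≡false → ⊥-elim (true≢false (trans (sym (D≡⊤ i)) Di≡false))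
  ; pos∈D = D≡⊤ ; pos-onto-D = λ i _ → i , refl ; pos-injective = λ _ _ e → e
  ; m≡∣D∣ = trans (sym (∣⊤∣≡n n)) (cong ∣_∣ (‼-ext {A = fullSet} {B = D} λ i → trans (‼-⊤ i) (sym (D≡⊤ i))))
  ; extend-size = λ A B → +-comm ∣ A ∣ ∣ B ∣ }

restriction-fixing : ∀ {n} (S : SetSystem (suc n)) D X → S X ≡ true → ∀ e → D ‼ e ≡ false →
  Restriction (λ A → S (insertAt A e (X ‼ e))) (removeAt D e) (removeAt X e) → Restriction S D X
restriction-fixing S D X X∈S e De≡false R = record
  { m = R.m ; N = R.N ; minor = fix-minor S e X X∈S R.minor
  ; extend = extend ; pos = λ j → punchIn e (R.pos j)
  ; N≡S∘extend = R.N≡S∘extend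
  ; ‼-extend-pos = λ A j → trans (insertAt-punchIn (R.extend A) e (X ‼ e) (R.pos j)) (R.‼-extend-pos A j)
  ; ‼-extend-off-D = ‼-extend-off-D
  ; pos∈D = λ j → trans (sym (‼-removeAt D e (R.pos j))) (R.pos∈D j)
  ; pos-onto-D = pos-onto-D
  ; pos-injective = λ j j′ eq → R.pos-injective j j′ (punchIn-injective e _ _ eq)
  ; m≡∣D∣ = trans R.m≡∣D∣ (∣removeAt∣ D e De≡false)
  ; extend-size = extend-size }
  where
  module R = Restriction R
  extend : Subset R.m → Subset _
  extend A = insertAt (R.extend A) e (X ‼ e)
  ‼-extend-off-D : ∀ A i → D ‼ i ≡ false → extend A ‼ i ≡ X ‼ i
  ‼-extend-off-D A i Di≡false with punchView e i
  ... | at-e = insertAt-lookup (R.extend A) e (X ‼ e)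
  ... | punched k = trans (insertAt-punchIn (R.extend A) e (X ‼ e) k)
    (trans (R.‼-extend-off-D A k (trans (‼-removeAt D e k) Di≡false)) (‼-removeAt X e k))
  pos-onto-D : ∀ i → D ‼ i ≡ true → ∃ λ j → punchIn e (R.pos j) ≡ i
  pos-onto-D i Di≡true with punchView e i
  ... | at-e = ⊥-elim (true≢false (trans (sym Di≡true) De≡false))
  ... | punched k with R.pos-onto-D k (trans (‼-removeAt D e k) Di≡true)
  ...   | j , pos-j = j , cong (punchIn e) pos-j
  extend-size : ∀ A B → ∣ extend A ∣ + ∣ B ∣ ≡ ∣ extend B ∣ + ∣ A ∣
  extend-size A B rewrite ∣insertAt∣ (R.extend A) e (X ‼ e) | ∣insertAt∣ (R.extend B) e (X ‼ e) =
    cons-size (X ‼ e) (R.extend A) (R.extend B) (R.extend-size A B)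
    where
    cons-size : ∀ {k} b (V W : Subset k) {p q} → ∣ V ∣ + p ≡ ∣ W ∣ + q → ∣ b ∷ V ∣ + p ≡ ∣ b ∷ W ∣ + q
    cons-size true V W eq = cong suc eq
    cons-size false V W eq = eq

restrict : ∀ {n} (S : SetSystem n) (D X : Subset n) → S X ≡ true → Restriction S D X
restrict {zero} S D X _ = whole-restriction S D X (λ ())
restrict {suc n} S D X X∈S with any? (λ e → D ‼ e ≟𝔹 false)
... | yes (e , De≡false) = restriction-fixing S D X X∈S e De≡false
  (restrict _ (removeAt D e) (removeAt X e) (trans (cong S (insertAt-removeAt X e)) X∈S))
... | no D≡⊤ = whole-restriction S D X (λ e → ¬-not (λ De≡false → D≡⊤ (e , De≡false)))

module RestrictionProperties {n} {S : SetSystem n} {D X : Subset n} (R : Restriction S D X) where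
  open Restriction R

  project : Subset n → Subset m
  project A = tabulate (λ j → A ‼ pos j)

  ‼-project : ∀ A j → project A ‼ j ≡ A ‼ pos j
  ‼-project A = lookup∘tabulate (λ j → A ‼ pos j)

  project-extend : ∀ A → project (extend A) ≡ A
  project-extend A = ‼-ext λ j → trans (‼-project (extend A) j) (‼-extend-pos A j)

  extend-project : ∀ Z → (∀ i → D ‼ i ≡ false → Z ‼ i ≡ X ‼ i) → extend (project Z) ≡ Z
  extend-project Z Z≡X-off-D = ‼-ext pointwise
    where
    pointwise : ∀ i → extend (project Z) ‼ i ≡ Z ‼ i
    pointwise i with D ‼ i in Di
    ... | false = trans (‼-extend-off-D (project Z) i Di) (sym (Z≡X-off-D i Di))
    ... | true with pos-onto-D i Di
    ...   | j , refl = trans (‼-extend-pos (project Z) j) (‼-project Z j)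

  project-△ : ∀ A B → project (A △ B) ≡ project A △ project B
  project-△ A B = ‼-ext λ j → trans (‼-project (A △ B) j) (trans (‼-△ A B (pos j))
    (sym (trans (‼-△ (project A) (project B) j) (cong₂ _xor_ (‼-project A j) (‼-project B j)))))

  project-doubleton : ∀ j j′ → project (doubleton (pos j) (pos j′)) ≡ doubleton j j′
  project-doubleton j j′ = ‼-ext λ k → trans (‼-project (doubleton (pos j) (pos j′)) k)
    (trans (‼-doubleton (pos j) (pos j′) (pos k))
    (sym (trans (‼-doubleton j j′ k)
      (cong₂ _∨_ (sym (‼-⁅⁆-injective pos pos-injective j k)) (sym (‼-⁅⁆-injective pos pos-injective j′ k))))))

-- Recognising excluded systems

ExcludedIso : ∀ {m} → SetSystem m → Set
ExcludedIso N = Σ ℕ λ m′ → Σ (SetSystem m′) λ T → Excluded m′ T × Isomorphic N T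

same-feasible-sets : ∀ {m} {N T : SetSystem m} → (∀ A → N A ≡ true → T A ≡ true) →
  (∀ A → T A ≡ true → N A ≡ true) → ∀ A → N A ≡ T A
same-feasible-sets N⊆T T⊆N A = ⇔→≡ (mk⇔ (N⊆T A) (T⊆N A))

image-identity : ∀ {m} (A : Subset m) → image (↔-id (Fin m)) A ≡ A
image-identity A = ‼-ext (lookup∘tabulate (A ‼_))

twisted-Sₘ-excluded : ∀ {m} (N : SetSystem m) k → m ≡ 2 * k → 2 ≤ k → ∀ X → ∣ X ∣ ≢ ∣ ∁ X ∣ →
  N X ≡ true → N (∁ X) ≡ true → (∀ A → N A ≡ true → A ≡ X ⊎ A ≡ ∁ X) → ExcludedIso N
twisted-Sₘ-excluded N k refl 2≤k X ∣X∣≢∣∁X∣ X∈N ∁X∈N only =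
  2 * k , twist (Sₘ (2 * k)) X , ex-S k 2≤k X ∣X∣≢k , ↔-id _ ,
  λ A → trans (same-feasible-sets N⊆T T⊆N A) (cong (twist (Sₘ (2 * k)) X) (sym (image-identity A)))
  where
  ∣X∣≢k : ∣ X ∣ ≢ k
  ∣X∣≢k ∣X∣≡k = ∣X∣≢∣∁X∣ (trans ∣X∣≡k (sym (begin
    ∣ ∁ X ∣         ≡⟨ ∣∁p∣≡n∸∣p∣ X ⟩
    2 * k ∸ ∣ X ∣   ≡⟨ cong (2 * k ∸_) ∣X∣≡k ⟩
    k + (k + 0) ∸ k ≡⟨ m+n∸m≡n k (k + 0) ⟩
    k + 0           ≡⟨ +-identityʳ k ⟩
    k               ∎)))
    where open ≡-Reasoning
  N⊆T : ∀ A → N A ≡ true → twist (Sₘ (2 * k)) X A ≡ true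
  N⊆T A A∈N with only A A∈N
  ... | inj₁ refl = twisted-Sₘ-∋ X
  ... | inj₂ refl = twisted-Sₘ-∋∁ X
  T⊆N : ∀ A → twist (Sₘ (2 * k)) X A ≡ true → N A ≡ true
  T⊆N A A∈T with twisted-Sₘ-feasible⇒ X A A∈T
  ... | inj₁ refl = X∈N
  ... | inj₂ refl = ∁X∈N

anyFinᵇ : ∀ n → (Fin n → Bool) → Bool
anyFinᵇ zero P = false
anyFinᵇ (suc n) P = P zero ∨ anyFinᵇ n (P ∘ suc)

anyFinᵇ-sound : ∀ n P → anyFinᵇ n P ≡ true → ∃ λ i → P i ≡ true
anyFinᵇ-sound (suc n) P h with ∨≡true⇒ (P zero) h
... | inj₁ P0 = zero , P0
... | inj₂ rest with anyFinᵇ-sound n (P ∘ suc) rest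
...   | i , Pi = suc i , Pi

anyFinᵇ-complete : ∀ n P i → P i ≡ true → anyFinᵇ n P ≡ true
anyFinᵇ-complete (suc n) P zero Pi rewrite Pi = refl
anyFinᵇ-complete (suc n) P (suc i) Pi = trans (cong (P zero ∨_) (anyFinᵇ-complete n (P ∘ suc) i Pi)) (∨-zeroʳ _)

infix 7 _≡ᵇ_
_≡ᵇ_ : ∀ {n} → Subset n → Subset n → Bool
A ≡ᵇ B = does (≡-dec _≟𝔹_ A B)

-- Feasible sets X, ∁ X and ∁ X △ {u, v} for u ≠ v ∈ B: the restriction of a minimal violation to
-- X △ Y has this shape.
canonical : ∀ {n} → Subset n → Fin n → Subset n → SetSystem n
canonical {n} X u B A = A ≡ᵇ X ∨ A ≡ᵇ ∁ X ∨ anyFinᵇ n (λ v → not (does (u ≟ᶠ v)) ∧ B ‼ v ∧ A ≡ᵇ ∁ X △ doubleton u v)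

canonical-∋ : ∀ {n} (X : Subset n) u B → canonical X u B X ≡ true
canonical-∋ X u B rewrite dec-true (≡-dec _≟𝔹_ X X) refl = refl

canonical-∋∁ : ∀ {n} (X : Subset n) u B → canonical X u B (∁ X) ≡ true
canonical-∋∁ X u B rewrite dec-true (≡-dec _≟𝔹_ (∁ X) (∁ X)) refl = ∨-zeroʳ (∁ X ≡ᵇ X)

canonical-∋-exchanged : ∀ {n} (X : Subset n) u B v → u ≢ v → B ‼ v ≡ true →
  canonical X u B (∁ X △ doubleton u v) ≡ true
canonical-∋-exchanged {n} X u B v u≢v Bv = trans (cong (λ b → A ≡ᵇ X ∨ A ≡ᵇ ∁ X ∨ b)
  (anyFinᵇ-complete n (λ w → not (does (u ≟ᶠ w)) ∧ B ‼ w ∧ A ≡ᵇ ∁ X △ doubleton u w) v chosen))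
  (trans (cong (A ≡ᵇ X ∨_) (∨-zeroʳ (A ≡ᵇ ∁ X))) (∨-zeroʳ (A ≡ᵇ X)))
  where
  A = ∁ X △ doubleton u v
  chosen : not (does (u ≟ᶠ v)) ∧ B ‼ v ∧ A ≡ᵇ A ≡ true
  chosen rewrite dec-false (u ≟ᶠ v) u≢v | Bv | dec-true (≡-dec _≟𝔹_ A A) refl = refl

canonical-feasible⇒ : ∀ {n} (X : Subset n) u B A → canonical X u B A ≡ true →
  A ≡ X ⊎ A ≡ ∁ X ⊎ ∃ λ v → B ‼ v ≡ true × A ≡ ∁ X △ doubleton u v
canonical-feasible⇒ {n} X u B A A∈ with ∨≡true⇒ (A ≡ᵇ X) A∈
... | inj₁ A≡X = inj₁ (does⇒ (≡-dec _≟𝔹_ A X) A≡X)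
... | inj₂ A∈′ with ∨≡true⇒ (A ≡ᵇ ∁ X) A∈′
...   | inj₁ A≡∁X = inj₂ (inj₁ (does⇒ (≡-dec _≟𝔹_ A (∁ X)) A≡∁X))
...   | inj₂ A∈″ with anyFinᵇ-sound n _ A∈″
...     | v , chosen = inj₂ (inj₂ (v , ∧-conicalˡ _ _ rest , does⇒ (≡-dec _≟𝔹_ A _) (∧-conicalʳ _ _ rest)))
  where
  rest = ∧-conicalʳ (not (does (u ≟ᶠ v))) _ chosen

canonical-recognised : ∀ {m} (N : SetSystem m) X u → N X ≡ true → N (∁ X) ≡ true →
  (∀ A → N A ≡ true → A ≡ X ⊎ A ≡ ∁ X ⊎ ∃ λ v → u ≢ v × A ≡ ∁ X △ doubleton u v) →
  ∀ A → N A ≡ canonical X u (tabulate λ v → N (∁ X △ doubleton u v)) A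
canonical-recognised N X u X∈N ∁X∈N shape = same-feasible-sets N⊆canonical canonical⊆N
  where
  B = tabulate λ v → N (∁ X △ doubleton u v)
  ‼-B : ∀ v → B ‼ v ≡ N (∁ X △ doubleton u v)
  ‼-B = lookup∘tabulate (λ v → N (∁ X △ doubleton u v))
  N⊆canonical : ∀ A → N A ≡ true → canonical X u B A ≡ true
  N⊆canonical A A∈N with shape A A∈N
  ... | inj₁ refl = canonical-∋ X u B
  ... | inj₂ (inj₁ refl) = canonical-∋∁ X u B
  ... | inj₂ (inj₂ (v , u≢v , refl)) = canonical-∋-exchanged X u B v u≢v (trans (‼-B v) A∈N)
  canonical⊆N : ∀ A → canonical X u B A ≡ true → N A ≡ true
  canonical⊆N A A∈canonical with canonical-feasible⇒ X u B A A∈canonical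
  ... | inj₁ refl = X∈N
  ... | inj₂ (inj₁ refl) = ∁X∈N
  ... | inj₂ (inj₂ (v , Bv , refl)) = trans (sym (‼-B v)) Bv

allSubsetsᵇ : ∀ n → (Subset n → Bool) → Bool
allSubsetsᵇ zero P = P []
allSubsetsᵇ (suc n) P = allSubsetsᵇ n (P ∘ (true ∷_)) ∧ allSubsetsᵇ n (P ∘ (false ∷_))

allSubsetsᵇ-sound : ∀ n P → allSubsetsᵇ n P ≡ true → ∀ A → P A ≡ true
allSubsetsᵇ-sound zero P h [] = h
allSubsetsᵇ-sound (suc n) P h (true ∷ A) = allSubsetsᵇ-sound n (P ∘ (true ∷_)) (∧-conicalˡ _ _ h) A
allSubsetsᵇ-sound (suc n) P h (false ∷ A) = allSubsetsᵇ-sound n (P ∘ (false ∷_)) (∧-conicalʳ _ _ h) A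

permutations : ∀ n → List (Fin n ↔ Fin n)
permutations zero = [ idₚ ]
permutations (suc n) = concatMap (λ π → map (λ j → insert zero j π) (allFin (suc n))) (permutations n)

isomorphicᵇ : ∀ {n} → SetSystem n → SetSystem n → Fin n ↔ Fin n → Bool
isomorphicᵇ {n} N T φ = allSubsetsᵇ n (λ A → does (N A ≟𝔹 T (image φ A)))

isomorphicᵇ-sound : ∀ {n} (N T : SetSystem n) φ → isomorphicᵇ N T φ ≡ true → Isomorphic N T
isomorphicᵇ-sound {n} N T φ h = φ , λ A → does⇒ (N A ≟𝔹 T (image φ A)) (allSubsetsᵇ-sound n _ h A)

record Candidate : Set where
  constructor candidate
  field
    {target} : SetSystem 4
    excluded : Excluded 4 target

excludedOn4 : List Candidate
excludedOn4 = candidate ex-T5 ∷ candidate ex-T5a ∷ candidate ex-T5bcd ∷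
  candidate ex-T6 ∷ candidate ex-T6a ∷ candidate ex-T6b ∷ candidate ex-T6bcd ∷
  candidate ex-T7 ∷ candidate ex-T7a ∷ candidate ex-T7b ∷ candidate ex-T7bcd ∷ candidate ex-T7acd ∷ candidate ex-T7dual ∷ []

candidates : Subset 4 → List Candidate
candidates X with ∣ X ∣ ≟ℕ 2
... | yes _ = excludedOn4
... | no ∣X∣≢2 = candidate (ex-S 2 (s≤s (s≤s z≤n)) X ∣X∣≢2) ∷ excludedOn4

-- The sum of 7 ^ ∣ A ∣ over the feasible sets A.  No size class of subsets of a 4-set has more than
-- 6 members, so on Fin 4 this records how many feasible sets there are of each size; it is an
-- isomorphism invariant, used only to prune the search.
sizeProfile : ∀ {n} → SetSystem n → ℕ
sizeProfile {zero} S = if S [] then 1 else 0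
sizeProfile {suc n} S = 7 * sizeProfile (S ∘ (true ∷_)) + sizeProfile (S ∘ (false ∷_))

isomorphismVia : (N : SetSystem 4) → Candidate → List (Fin 4 ↔ Fin 4) → Maybe (ExcludedIso N)
isomorphismVia N c [] = nothing
isomorphismVia N c@(candidate {T} ex) (φ ∷ φs) with isomorphicᵇ N T φ in found
... | true = just (4 , T , ex , isomorphicᵇ-sound N T φ found)
... | false = isomorphismVia N c φs

findIsomorphism : (N : SetSystem 4) → List Candidate → Maybe (ExcludedIso N)
findIsomorphism N [] = nothing
findIsomorphism N (c ∷ cs) with sizeProfile N ≟ℕ sizeProfile (Candidate.target c)
... | yes _ = isomorphismVia N c (permutations 4) <∣> findIsomorphism N cs
... | no _ = findIsomorphism N cs

excludedIsoᵇ : Subset 4 → Fin 4 → Subset 4 → Bool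
excludedIsoᵇ X u B = is-just (findIsomorphism (canonical X u B) (candidates X))

canonical-on-4-excluded : allSubsetsᵇ 4 (λ X → does (∣ X ∣ ≟ℕ 2) ∨ allFinᵇ 4 (λ u → allSubsetsᵇ 4 (excludedIsoᵇ X u))) ≡ true
canonical-on-4-excluded = refl

∨-false-rest : ∀ {a b} → a ≡ false → a ∨ b ≡ true → b ≡ true
∨-false-rest refl b≡true = b≡true

is-just⇒ : ∀ {A : Set} (m : Maybe A) → is-just m ≡ true → A
is-just⇒ (just a) _ = a

canonical-excluded : ∀ X u B → ∣ X ∣ ≢ 2 → ExcludedIso (canonical X u B)
canonical-excluded X u B ∣X∣≢2 = is-just⇒ (findIsomorphism (canonical X u B) (candidates X))
  (allSubsetsᵇ-sound 4 (excludedIsoᵇ X u) (allFinᵇ-sound 4 (λ u → allSubsetsᵇ 4 (excludedIsoᵇ X u)) found-for-X u) B)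
  where
  found-for-X : allFinᵇ 4 (λ u → allSubsetsᵇ 4 (excludedIsoᵇ X u)) ≡ true
  found-for-X = ∨-false-rest (dec-false (∣ X ∣ ≟ℕ 2) ∣X∣≢2)
    (allSubsetsᵇ-sound 4 (λ X → does (∣ X ∣ ≟ℕ 2) ∨ allFinᵇ 4 (λ u → allSubsetsᵇ 4 (excludedIsoᵇ X u)))
      canonical-on-4-excluded X)

excluded-on-4 : ∀ {m} (N : SetSystem m) → m ≡ 4 → ∀ X u → ∣ X ∣ ≢ ∣ ∁ X ∣ → N X ≡ true → N (∁ X) ≡ true →
  (∀ A → N A ≡ true → A ≡ X ⊎ A ≡ ∁ X ⊎ ∃ λ v → u ≢ v × A ≡ ∁ X △ doubleton u v) → ExcludedIso N
excluded-on-4 N refl X u ∣X∣≢∣∁X∣ X∈N ∁X∈N shape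
  with canonical-excluded X u (tabulate λ v → N (∁ X △ doubleton u v)) ∣X∣≢2
  where
  ∣X∣≢2 : ∣ X ∣ ≢ 2
  ∣X∣≢2 ∣X∣≡2 = ∣X∣≢∣∁X∣ (trans ∣X∣≡2 (sym (trans (∣∁p∣≡n∸∣p∣ X) (cong (4 ∸_) ∣X∣≡2))))
... | m′ , T , excluded , φ , canonical≅T =
  m′ , T , excluded , φ , λ A → trans (canonical-recognised N X u X∈N ∁X∈N shape A) (canonical≅T A)

-- Minimal violations of even matroid stacks

layer-∋ : ∀ {n} (S : SetSystem n) A k → S A ≡ true → ∣ A ∣ ≡ k → layer S k A ≡ true
layer-∋ S A k A∈S ∣A∣≡k rewrite A∈S = dec-true (∣ A ∣ ≟ℕ k) ∣A∣≡k

layer-exchange : ∀ {n} {S : SetSystem n} → IsMatroidStack S → ∀ P Q → S P ≡ true → S Q ≡ true → ∣ P ∣ ≡ ∣ Q ∣ →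
  ∀ x → (P ─ Q) ‼ x ≡ true → ∃ λ y → (Q ─ P) ‼ y ≡ true × S ((P ─ ⁅ x ⁆) ∪ ⁅ y ⁆) ≡ true
layer-exchange {S = S} stack P Q P∈S Q∈S ∣P∣≡∣Q∣ x x∈P─Q
  with proj₂ (stack ∣ P ∣ (P , P∈L)) P Q P∈L (layer-∋ S Q ∣ P ∣ Q∈S (sym ∣P∣≡∣Q∣)) x (lookup⇒[]= x (P ─ Q) x∈P─Q)
  where
  P∈L = layer-∋ S P ∣ P ∣ P∈S refl
... | y , y∈Q─P , swapped∈L = y , []=⇒lookup y∈Q─P , ∧-conicalˡ _ _ swapped∈L

Exchange : ∀ {n} → SetSystem n → Subset n → Subset n → Fin n → Set
Exchange S P Q w = ∃ λ v → (P △ Q) ‼ v ≡ true × S (P △ doubleton w v) ≡ true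

exchange? : ∀ {n} (S : SetSystem n) P Q w →
  Exchange S P Q w ⊎ (∀ v → (P △ Q) ‼ v ≡ true → S (P △ doubleton w v) ≡ false)
exchange? S P Q w with any? (λ v → ((P △ Q) ‼ v ≟𝔹 true) ×-dec (S (P △ doubleton w v) ≟𝔹 true))
... | yes exchange = inj₁ exchange
... | no no-exchange = inj₂ λ v v∈P△Q → ¬-not λ exchanged → no-exchange (v , v∈P△Q , exchanged)

Minimal : ∀ {n} {S : SetSystem n} → Violation S → Set
Minimal {S = S} (violation X Y _ _ _ _ _) = ∀ P Q → S P ≡ true → S Q ≡ true → ∣ P △ Q ∣ < ∣ X △ Y ∣ →
  ∀ w → (P △ Q) ‼ w ≡ true → Exchange S P Q w

module MinimalViolation {n} {S : SetSystem n} (ems : IsEvenMatroidStackSetSystem S) (V : Violation S)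
  (exchange-below : Minimal V) where

  open Violation V

  D : Subset n
  D = X △ Y

  X≢Y-on-D : ∀ {i} → D ‼ i ≡ true → X ‼ i ≢ Y ‼ i
  X≢Y-on-D {i} Di Xi≡Yi = true≢false (trans (sym Di) (‼-△-≡ X Y i Xi≡Yi))

  Y-on-D : ∀ {i} → D ‼ i ≡ true → Y ‼ i ≡ not (X ‼ i)
  Y-on-D Di = ¬-not (λ Yi≡Xi → X≢Y-on-D Di (sym Yi≡Xi))

  off-D≢on-D : ∀ {i j} → D ‼ i ≡ false → D ‼ j ≡ true → i ≢ j
  off-D≢on-D Di Dj refl = true≢false (trans (sym Dj) Di)

  Between : Subset n → Set
  Between Z = ∀ i → D ‼ i ≡ false → Z ‼ i ≡ X ‼ i

  between-X : Between X
  between-X i _ = refl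

  between-Y : Between Y
  between-Y i Di = sym (xor≡false⇒≡ (X ‼ i) (Y ‼ i) (trans (sym (‼-△ X Y i)) Di))

  between-△⊆D : ∀ Z W → Between Z → Between W → ∀ i → (Z △ W) ‼ i ≡ true → D ‼ i ≡ true
  between-△⊆D Z W bZ bW i i∈Z△W = ¬-not λ Di → true≢false
    (trans (sym i∈Z△W) (‼-△-≡ Z W i (trans (bZ i Di) (sym (bW i Di)))))

  between-△-doubleton : ∀ Z a b → D ‼ a ≡ true → D ‼ b ≡ true → Between Z → Between (Z △ doubleton a b)
  between-△-doubleton Z a b Da Db bZ i Di =
    trans (‼-△-doubleton-other Z a b i (off-D≢on-D Di Da) (off-D≢on-D Di Db)) (bZ i Di)

  closer : ∀ Z W j → Between Z → Between W → D ‼ j ≡ true → Z ‼ j ≡ W ‼ j → ∣ Z △ W ∣ < ∣ D ∣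
  closer Z W j bZ bW Dj Zj≡Wj = ‼⊂⇒∣∣< (Z △ W) D j (between-△⊆D Z W bZ bW) Dj (‼-△-≡ Z W j Zj≡Wj)

  -- Otherwise X and Z are a closer pair, and exchanging u from X towards Z contradicts the violation.
  flipped-at-u⇒≡Y : ∀ Z → S Z ≡ true → Between Z → Z ‼ u ≢ X ‼ u → Z ≡ Y
  flipped-at-u⇒≡Y Z Z∈S bZ Zu≢Xu with ≡-dec _≟𝔹_ Z Y
  ... | yes Z≡Y = Z≡Y
  ... | no Z≢Y with ‼-≢ Z≢Y
  ...   | j , Zj≢Yj
    with exchange-below X Z X-feasible Z∈S
           (closer X Z j between-X bZ Dj (sym (≢not⇒≡ (λ e → Zj≢Yj (trans e (sym (Y-on-D Dj)))))))
           u (‼-△-≢ X Z u (λ e → Zu≢Xu (sym e)))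
    where
    Dj : D ‼ j ≡ true
    Dj = between-△⊆D Z Y bZ between-Y j (‼-△-≢ Z Y j Zj≢Yj)
  ... | v , v∈X△Z , exchanged =
    ⊥-elim (true≢false (trans (sym exchanged) (no-exchange v (between-△⊆D X Z between-X bZ v v∈X△Z))))

  fixed-at-u⇒≡Y△ : ∀ Z → S Z ≡ true → Between Z → Z ‼ u ≡ X ‼ u → Z ≢ X →
    ∃ λ v → D ‼ v ≡ true × Z ≡ Y △ doubleton u v
  fixed-at-u⇒≡Y△ Z Z∈S bZ Zu≡Xu Z≢X with ‼-≢ Z≢X
  ... | j , Zj≢Xj
    with exchange-below Z Y Z∈S Y-feasible (closer Z Y j bZ between-Y Dj (trans (¬-not Zj≢Xj) (sym (Y-on-D Dj))))
           u (‼-△-≢ Z Y u (λ Zu≡Yu → X≢Y-on-D u∈X△Y (trans (sym Zu≡Xu) Zu≡Yu)))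
    where
    Dj : D ‼ j ≡ true
    Dj = between-△⊆D Z X bZ between-X j (‼-△-≢ Z X j Zj≢Xj)
  ... | v , v∈Z△Y , exchanged = v , Dv , trans (sym (p△q△q≡p Z (doubleton u v))) (cong (_△ doubleton u v) W≡Y)
    where
    Dv : D ‼ v ≡ true
    Dv = between-△⊆D Z Y bZ between-Y v v∈Z△Y
    W≡Y : Z △ doubleton u v ≡ Y
    W≡Y = flipped-at-u⇒≡Y (Z △ doubleton u v) exchanged (between-△-doubleton Z u v u∈X△Y Dv bZ) λ Wu≡Xu →
      not-¬ refl (trans (sym Wu≡Xu) (trans (‼-△-doubleton-∈ Z u v u (‼-doubletonˡ u v)) (cong not Zu≡Xu)))

  between-feasible⇒ : ∀ Z → S Z ≡ true → Between Z → Z ≡ X ⊎ Z ≡ Y ⊎ ∃ λ v → D ‼ v ≡ true × Z ≡ Y △ doubleton u v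
  between-feasible⇒ Z Z∈S bZ with Z ‼ u ≟𝔹 X ‼ u
  ... | no Zu≢Xu = inj₂ (inj₁ (flipped-at-u⇒≡Y Z Z∈S bZ Zu≢Xu))
  ... | yes Zu≡Xu with ≡-dec _≟𝔹_ Z X
  ...   | yes Z≡X = inj₁ Z≡X
  ...   | no Z≢X = inj₂ (inj₂ (fixed-at-u⇒≡Y△ Z Z∈S bZ Zu≡Xu Z≢X))

  parity-feasible : ∀ {A B} → S A ≡ true → S B ≡ true → parity ∣ A ∣ ≡ parity ∣ B ∣
  parity-feasible {A} {B} A∈S B∈S = %2-cong-parity ∣ A ∣ ∣ B ∣ (proj₁ (proj₂ ems) A B A∈S B∈S)

  parity-D : parity ∣ D ∣ ≡ 0ℙ
  parity-D = parity-△ X Y (parity-feasible X-feasible Y-feasible)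

  Y△uv-feasible⇒u≢v : ∀ v → S (Y △ doubleton u v) ≡ true → u ≢ v
  Y△uv-feasible⇒u≢v v Z∈S refl = p≢p⁻¹ (parity ∣ Y ∣)
    (trans (sym (parity-feasible (subst (λ B → S (Y △ B) ≡ true) (∪-idem ⁅ u ⁆) Z∈S) Y-feasible)) (parity-△⁅x⁆ Y u))

  equal-sizes-u∈X⇒∣D∣≤2 : ∣ X ∣ ≡ ∣ Y ∣ → X ‼ u ≡ true → ∣ D ∣ ≤ 2
  equal-sizes-u∈X⇒∣D∣≤2 ∣X∣≡∣Y∣ Xu
    with layer-exchange (proj₂ (proj₂ ems)) X Y X-feasible Y-feasible ∣X∣≡∣Y∣ u
           (‼-─⇐ X Y u Xu (trans (Y-on-D u∈X△Y) (cong not Xu)))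
  ... | y , y∈Y─X , W∈S = only-two-members⇒∣∣≤2 D u y λ i Di i≢u i≢y →
    X≢Y-on-D Di (trans (sym (‼-swap-other X u y i i≢u i≢y)) (cong (_‼ i) W≡Y))
    where
    W = (X ─ ⁅ u ⁆) ∪ ⁅ y ⁆
    Xy≡false : X ‼ y ≡ false
    Xy≡false = proj₂ (‼-─⇒ Y X y y∈Y─X)
    y≢u : y ≢ u
    y≢u refl = true≢false (trans (sym Xu) Xy≡false)
    Dy : D ‼ y ≡ true
    Dy = ‼-△-≢ X Y y λ Xy≡Yy → true≢false (trans (sym (proj₁ (‼-─⇒ Y X y y∈Y─X))) (trans (sym Xy≡Yy) Xy≡false))
    W≡Y : W ≡ Y
    W≡Y = flipped-at-u⇒≡Y W W∈S (λ i Di → ‼-swap-other X u y i (off-D≢on-D Di u∈X△Y) (off-D≢on-D Di Dy))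
      λ Wu≡Xu → true≢false (trans (sym Xu) (trans (sym Wu≡Xu) (‼-swap-removed X u y y≢u)))

  equal-sizes⇒Y─X⊆⁅u⁆ : ∣ X ∣ ≡ ∣ Y ∣ → X ‼ u ≡ false → ∀ x → (Y ─ X) ‼ x ≡ true → x ≢ u → ⊥
  equal-sizes⇒Y─X⊆⁅u⁆ ∣X∣≡∣Y∣ Xu x x∈Y─X x≢u
    with layer-exchange (proj₂ (proj₂ ems)) Y X Y-feasible X-feasible (sym ∣X∣≡∣Y∣) x x∈Y─X
  ... | y , y∈X─Y , W∈S = true≢false (trans (sym Yx) (trans (cong (_‼ x) (sym W≡Y)) (‼-swap-removed Y x y y≢x)))
    where
    W = (Y ─ ⁅ x ⁆) ∪ ⁅ y ⁆
    Yx = proj₁ (‼-─⇒ Y X x x∈Y─X)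
    Xx = proj₂ (‼-─⇒ Y X x x∈Y─X)
    Xy = proj₁ (‼-─⇒ X Y y y∈X─Y)
    Yy = proj₂ (‼-─⇒ X Y y y∈X─Y)
    y≢x : y ≢ x
    y≢x refl = true≢false (trans (sym Xy) Xx)
    y≢u : y ≢ u
    y≢u refl = true≢false (trans (sym Xy) Xu)
    Dx : D ‼ x ≡ true
    Dx = ‼-△-≢ X Y x λ e → true≢false (trans (sym Yx) (trans (sym e) Xx))
    Dy : D ‼ y ≡ true
    Dy = ‼-△-≢ X Y y λ e → true≢false (trans (sym Xy) (trans e Yy))
    W≡Y : W ≡ Y
    W≡Y = flipped-at-u⇒≡Y W W∈S
      (λ i Di → trans (‼-swap-other Y x y i (off-D≢on-D Di Dx) (off-D≢on-D Di Dy)) (between-Y i Di))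
      λ Wu≡Xu → X≢Y-on-D u∈X△Y (trans (sym Wu≡Xu) (‼-swap-other Y x y u (λ e → x≢u (sym e)) (λ e → y≢u (sym e))))

  equal-sizes-u∉X⇒∣D∣≤2 : ∣ X ∣ ≡ ∣ Y ∣ → X ‼ u ≡ false → ∣ D ∣ ≤ 2
  equal-sizes-u∉X⇒∣D∣≤2 ∣X∣≡∣Y∣ Xu = begin
    ∣ D ∣                    ≡⟨ ∣p△q∣≡∣p─q∣+∣q─p∣ X Y ⟩
    ∣ X ─ Y ∣ + ∣ Y ─ X ∣    ≡⟨ cong (_+ ∣ Y ─ X ∣) (∣p∣≡∣q∣⇒∣p─q∣≡∣q─p∣ X Y ∣X∣≡∣Y∣) ⟩
    ∣ Y ─ X ∣ + ∣ Y ─ X ∣    ≤⟨ +-mono-≤ ∣Y─X∣≤1 ∣Y─X∣≤1 ⟩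
    2                        ∎
    where
    open ≤-Reasoning
    ∣Y─X∣≤1 : ∣ Y ─ X ∣ ≤ 1
    ∣Y─X∣≤1 = ≤-trans (p⊆q⇒∣p∣≤∣q∣ (‼⇒⊆ (Y ─ X) ⁅ u ⁆ λ i i∈Y─X →
      subst (λ j → ⁅ u ⁆ ‼ j ≡ true) (sym (decidable-stable (i ≟ᶠ u) (equal-sizes⇒Y─X⊆⁅u⁆ ∣X∣≡∣Y∣ Xu i i∈Y─X)))
        (‼-⁅x⁆-self u))) (≤-reflexive (∣⁅x⁆∣≡1 u))

  equal-sizes⇒∣D∣≤2 : ∣ X ∣ ≡ ∣ Y ∣ → ∣ D ∣ ≤ 2
  equal-sizes⇒∣D∣≤2 ∣X∣≡∣Y∣ with X ‼ u in Xu
  ... | true = equal-sizes-u∈X⇒∣D∣≤2 ∣X∣≡∣Y∣ Xu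
  ... | false = equal-sizes-u∉X⇒∣D∣≤2 ∣X∣≡∣Y∣ Xu

  ∣D∣≤2⇒⊥ : ∣ D ∣ ≤ 2 → ⊥
  ∣D∣≤2⇒⊥ ∣D∣≤2 with ∣∣≤2⇒⊆doubleton D u u∈X△Y ∣D∣≤2
  ... | v , Dv , only-u-v = true≢false (trans (sym (trans (cong S X△uv≡Y) Y-feasible)) (no-exchange v Dv))
    where
    X△uv≡Y : X △ doubleton u v ≡ Y
    X△uv≡Y = ‼-ext pointwise
      where
      pointwise : ∀ i → (X △ doubleton u v) ‼ i ≡ Y ‼ i
      pointwise i with D ‼ i in Di
      ... | true = trans (‼-△-doubleton-∈ X u v i (‼-doubleton-¬∉ u v i (only-u-v i Di))) (sym (Y-on-D Di))
      ... | false = trans (‼-△-doubleton-other X u v i (off-D≢on-D Di u∈X△Y) (off-D≢on-D Di Dv)) (sym (between-Y i Di))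

  exchanged-from-X⇒∣D∣≤4 : ∀ w v → D ‼ w ≡ true → D ‼ v ≡ true → S (X △ doubleton w v) ≡ true → ∣ D ∣ ≤ 4
  exchanged-from-X⇒∣D∣≤4 w v Dw Dv W∈S
    with between-feasible⇒ (X △ doubleton w v) W∈S (between-△-doubleton X w v Dw Dv between-X)
  ... | inj₁ W≡X = ⊥-elim (not-¬ refl (trans (cong (_‼ w) (sym W≡X)) (‼-△-doubleton-∈ X w v w (‼-doubletonˡ w v))))
  ... | inj₂ (inj₁ W≡Y) = ≤-trans (only-two-members⇒∣∣≤2 D w v λ i Di i≢w i≢v →
    X≢Y-on-D Di (trans (sym (‼-△-doubleton-other X w v i i≢w i≢v)) (cong (_‼ i) W≡Y))) (s≤s (s≤s z≤n))
  ... | inj₂ (inj₂ (v′ , _ , W≡Y△uv′)) = only-four-members⇒∣∣≤4 D w v u v′ λ i Di i≢w i≢v i≢u i≢v′ →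
    X≢Y-on-D Di (trans (sym (‼-△-doubleton-other X w v i i≢w i≢v))
      (trans (cong (_‼ i) W≡Y△uv′) (‼-△-doubleton-other Y u v′ i i≢u i≢v′)))

  large⇒Y△uv-infeasible : 5 ≤ ∣ D ∣ → ∀ v → D ‼ v ≡ true → S (Y △ doubleton u v) ≡ true → ⊥
  large⇒Y△uv-infeasible 5≤∣D∣ v Dv Z∈S with any? (λ w → (D ‼ w ≟𝔹 true) ×-dec (¬? (w ≟ᶠ u) ×-dec ¬? (w ≟ᶠ v)))
  ... | no only-u-v = <⇒≱ (≤-trans (s≤s (s≤s (s≤s z≤n))) 5≤∣D∣)
    (only-two-members⇒∣∣≤2 D u v λ i Di i≢u i≢v → only-u-v (i , Di , i≢u , i≢v))
  ... | yes (w , Dw , w≢u , w≢v)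
    with exchange-below X Z X-feasible Z∈S (closer X Z u between-X bZ u∈X△Y (sym Zu≡Xu)) w
           (‼-△-≢ X Z w λ Xw≡Zw → X≢Y-on-D Dw (trans Xw≡Zw (‼-△-doubleton-other Y u v w w≢u w≢v)))
    where
    Z = Y △ doubleton u v
    bZ : Between Z
    bZ = between-△-doubleton Y u v u∈X△Y Dv between-Y
    Zu≡Xu : Z ‼ u ≡ X ‼ u
    Zu≡Xu = trans (‼-△-doubleton-∈ Y u v u (‼-doubletonˡ u v)) (trans (cong not (Y-on-D u∈X△Y)) (not-involutive (X ‼ u)))
  ... | v′ , v′∈X△Z , exchanged = <⇒≱ 5≤∣D∣ (exchanged-from-X⇒∣D∣≤4 w v′ Dw
    (between-△⊆D X (Y △ doubleton u v) between-X (between-△-doubleton Y u v u∈X△Y Dv between-Y) v′ v′∈X△Z) exchanged)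

  large⇒between-feasible⇒ : 5 ≤ ∣ D ∣ → ∀ Z → S Z ≡ true → Between Z → Z ≡ X ⊎ Z ≡ Y
  large⇒between-feasible⇒ 5≤∣D∣ Z Z∈S bZ with between-feasible⇒ Z Z∈S bZ
  ... | inj₁ Z≡X = inj₁ Z≡X
  ... | inj₂ (inj₁ Z≡Y) = inj₂ Z≡Y
  ... | inj₂ (inj₂ (v , Dv , refl)) = ⊥-elim (large⇒Y△uv-infeasible 5≤∣D∣ v Dv Z∈S)

  R : Restriction S D X
  R = restrict S D X X-feasible

  open Restriction R using (m; N; minor; extend; pos; N≡S∘extend; ‼-extend-off-D; pos∈D; pos-onto-D; m≡∣D∣; extend-size)
  open RestrictionProperties R

  X′ : Subset m
  X′ = project X

  project-Y : project Y ≡ ∁ X′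
  project-Y = ‼-ext λ j → trans (‼-project Y j)
    (trans (Y-on-D (pos∈D j)) (sym (trans (‼-∁ X′ j) (cong not (‼-project X j)))))

  extend-X′ : extend X′ ≡ X
  extend-X′ = extend-project X between-X

  extend-∁X′ : extend (∁ X′) ≡ Y
  extend-∁X′ = trans (cong extend (sym project-Y)) (extend-project Y between-Y)

  N-∋X′ : N X′ ≡ true
  N-∋X′ = trans (N≡S∘extend X′) (trans (cong S extend-X′) X-feasible)

  N-∋∁X′ : N (∁ X′) ≡ true
  N-∋∁X′ = trans (N≡S∘extend (∁ X′)) (trans (cong S extend-∁X′) Y-feasible)

  N-feasible⇒ : ∀ A → N A ≡ true → S (extend A) ≡ true
  N-feasible⇒ A A∈N = trans (sym (N≡S∘extend A)) A∈N

  between-extend : ∀ A → Between (extend A)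
  between-extend = ‼-extend-off-D

  ∣X′∣≢∣∁X′∣ : 2 < ∣ D ∣ → ∣ X′ ∣ ≢ ∣ ∁ X′ ∣
  ∣X′∣≢∣∁X′∣ 2<∣D∣ ∣X′∣≡∣∁X′∣ = <⇒≱ 2<∣D∣ (equal-sizes⇒∣D∣≤2 (+-cancelʳ-≡ (∣ X′ ∣) (∣ X ∣) (∣ Y ∣) (begin
    ∣ X ∣ + ∣ X′ ∣              ≡⟨ cong (λ A → ∣ A ∣ + ∣ X′ ∣) (sym extend-X′) ⟩
    ∣ extend X′ ∣ + ∣ X′ ∣      ≡⟨ cong (∣ extend X′ ∣ +_) ∣X′∣≡∣∁X′∣ ⟩
    ∣ extend X′ ∣ + ∣ ∁ X′ ∣    ≡⟨ extend-size X′ (∁ X′) ⟩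
    ∣ extend (∁ X′) ∣ + ∣ X′ ∣  ≡⟨ cong (λ A → ∣ A ∣ + ∣ X′ ∣) extend-∁X′ ⟩
    ∣ Y ∣ + ∣ X′ ∣              ∎)))
    where open ≡-Reasoning

  project-Y△uv : ∀ u′ v′ → pos u′ ≡ u → project (Y △ doubleton u (pos v′)) ≡ ∁ X′ △ doubleton u′ v′
  project-Y△uv u′ v′ refl = trans (project-△ Y _) (cong₂ _△_ project-Y (project-doubleton u′ v′))

  restriction-feasible⇒ : ∀ u′ → pos u′ ≡ u → ∀ A → N A ≡ true →
    A ≡ X′ ⊎ A ≡ ∁ X′ ⊎ ∃ λ v′ → u′ ≢ v′ × A ≡ ∁ X′ △ doubleton u′ v′
  restriction-feasible⇒ u′ pos-u′ A A∈N with between-feasible⇒ (extend A) (N-feasible⇒ A A∈N) (between-extend A)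
  ... | inj₁ A↑≡X = inj₁ (trans (sym (project-extend A)) (cong project A↑≡X))
  ... | inj₂ (inj₁ A↑≡Y) = inj₂ (inj₁ (trans (sym (project-extend A)) (trans (cong project A↑≡Y) project-Y)))
  ... | inj₂ (inj₂ (v , Dv , A↑≡Y△uv)) with pos-onto-D v Dv
  ...   | v′ , refl = inj₂ (inj₂ (v′ , u′≢v′ , trans (sym (project-extend A))
    (trans (cong project A↑≡Y△uv) (project-Y△uv u′ v′ pos-u′))))
    where
    u′≢v′ : u′ ≢ v′
    u′≢v′ u′≡v′ = Y△uv-feasible⇒u≢v (pos v′) (subst (λ B → S B ≡ true) A↑≡Y△uv (N-feasible⇒ A A∈N))
      (trans (sym pos-u′) (cong pos u′≡v′))

  large⇒restriction-feasible⇒ : 5 ≤ ∣ D ∣ → ∀ A → N A ≡ true → A ≡ X′ ⊎ A ≡ ∁ X′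
  large⇒restriction-feasible⇒ 5≤∣D∣ A A∈N
    with large⇒between-feasible⇒ 5≤∣D∣ (extend A) (N-feasible⇒ A A∈N) (between-extend A)
  ... | inj₁ A↑≡X = inj₁ (trans (sym (project-extend A)) (cong project A↑≡X))
  ... | inj₂ A↑≡Y = inj₂ (trans (sym (project-extend A)) (trans (cong project A↑≡Y) project-Y))

  excluded-restriction : ExcludedIso N
  excluded-restriction with even-size-cases ∣ D ∣ parity-D
  ... | inj₁ ∣D∣≤2 = ⊥-elim (∣D∣≤2⇒⊥ ∣D∣≤2)
  ... | inj₂ (inj₁ ∣D∣≡4) = excluded-on-4 N (trans m≡∣D∣ ∣D∣≡4) X′ (proj₁ (pos-onto-D u u∈X△Y))
    (∣X′∣≢∣∁X′∣ (subst (2 <_) (sym ∣D∣≡4) (s≤s (s≤s (s≤s z≤n))))) N-∋X′ N-∋∁X′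
    (restriction-feasible⇒ _ (proj₂ (pos-onto-D u u∈X△Y)))
  ... | inj₂ (inj₂ 6≤∣D∣) with parity≡0ℙ⇒double ∣ D ∣ parity-D
  ...   | k , ∣D∣≡k+k = twisted-Sₘ-excluded N k (trans m≡∣D∣ (trans ∣D∣≡k+k (cong (k +_) (sym (+-identityʳ k)))))
    (half-of-≥6 k (subst (6 ≤_) ∣D∣≡k+k 6≤∣D∣)) X′ (∣X′∣≢∣∁X′∣ (≤-trans (s≤s (s≤s (s≤s z≤n))) 6≤∣D∣))
    N-∋X′ N-∋∁X′ (large⇒restriction-feasible⇒ (≤-trans (n≤1+n 5) 6≤∣D∣))

  excluded-minor : HasExcludedMinor S
  excluded-minor = m , N , minor , excluded-restriction

no-minimal-violation⇒¬violation : ∀ {n} {S : SetSystem n} → (∀ (V : Violation S) → Minimal V → ⊥) → ¬ Violation S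
no-minimal-violation⇒¬violation {S = S} no-minimal V = bounded _ V ≤-refl
  where
  bounded : ∀ d (V : Violation S) → ∣ Violation.X V △ Violation.Y V ∣ ≤ d → ⊥
  bounded zero (violation X Y u _ _ u∈X△Y _) ∣X△Y∣≤0 =
    <⇒≱ (subst (0 <_) (sym (∣p∣≡1+∣p─⁅x⁆∣ (X △ Y) u u∈X△Y)) (s≤s z≤n)) ∣X△Y∣≤0
  bounded (suc d) V@(violation X Y _ _ _ _ _) ∣X△Y∣≤1+d = no-minimal V minimal
    where
    minimal : Minimal V
    minimal P Q P∈S Q∈S closer w w∈P△Q with exchange? S P Q w
    ... | inj₁ exchange = exchange
    ... | inj₂ no-exchange =
      ⊥-elim (bounded d (violation P Q w P∈S Q∈S w∈P△Q no-exchange) (≤-pred (≤-trans closer ∣X△Y∣≤1+d)))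

¬violation⇒exchange : ∀ {n} {S : SetSystem n} → ¬ Violation S → ∀ X Y → Feasible S X → Feasible S Y →
  ∀ u → u ∈ (X △ Y) → ∃ λ v → v ∈ (X △ Y) × Feasible S (X △ (⁅ u ⁆ ∪ ⁅ v ⁆))
¬violation⇒exchange {S = S} ¬V X Y X∈S Y∈S u u∈X△Y with exchange? S X Y u
... | inj₁ (v , v∈X△Y , exchanged) = v , lookup⇒[]= v (X △ Y) v∈X△Y , exchanged
... | inj₂ no-exchange = ⊥-elim (¬V (violation X Y u X∈S Y∈S ([]=⇒lookup u∈X△Y) no-exchange))

corollary6p4 : (n : ℕ) (S : SetSystem n) → IsEvenMatroidStackSetSystem S →
    (IsEvenMatroidStackDeltaMatroid S ⇔ (¬ HasExcludedMinor S))
corollary6p4 n S ems = mk⇔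
  (λ (_ , delta-matroid) → delta-matroid⇒¬excluded-minor delta-matroid)
  (λ no-excluded-minor → ems , proj₁ ems , ¬violation⇒exchange (no-minimal-violation⇒¬violation λ V below →
    no-excluded-minor (MinimalViolation.excluded-minor ems V below)))
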